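{- Let $k$ be an integer, let $d$ be sufficiently large, and let $Q=(V,E)$ be a component of $Q_{d,k}$. Let $A\subseteq V$ with $|A|\le|V|/2$ and $|E(A,V\setminus A)|\le(1+\epsilon)\binom{d-1}{k-1}|A|$ for some $\epsilon\ge0$, and let $f:\{0,1\}^d\to\{0,1\}$ be the indicator function of $A$. Then: if $k$ is odd, $\sum_{|S|\ge2}\widehat f(S)^2\le\frac\epsilon2$; if $k$ is even, $\sum_{2\le|S|\le d-2}\widehat f(S)^2\le\frac\epsilon2$.
   Context: $Q_{d,k}$ is the graph on $\{0,1\}^d$ in which two vertices are adjacent iff their Hamming distance is exactly $k$. A component of $Q_{d,k}$ is: $Q_{d,k}$ itself if $k$ is odd; if $k$ is even, the subgraph induced by the vertices of even Hamming weight or by those of odd Hamming weight. $E(A,V\setminus A)$ is the set of edges of $Q$ with exactly one endpoint in $A$. For $S\subseteq[d]$, $\chi_S(x)=(-1)^{\sum_{i\in S}x_i}$ and $\widehat f(S)=2^{ -d}\sum_{x\in\{0,1\}^d}f(x)\chi_S(x)$; sums are over $S\subseteq[d]$.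
   Formalization: The parameter ε takes values in the nonnegative rationals. -}

module Defs where

open import Data.Bool using (Bool; true; false; if_then_else_; _∧_; _xor_; not)
open import Data.Nat using (ℕ; zero; suc; _^_; _≤ᵇ_; _∸_; _*_)
open import Data.Nat.Properties using (m^n≢0)
open import Data.Integer using (ℤ; +_)
import Data.Integer as ℤ
open import Data.List using (List; map; filter; length; concatMap; foldr)
open import Data.Vec using (Vec; []; _∷_; zipWith)
import Data.List as L
open import Data.Rational using (ℚ; _/_)
import Data.Rational as ℚ
open import Relation.Nullary.Decidable using (Dec; yes; no)
open import Relation.Binary.PropositionalEquality using (_≡_)
open import Data.Bool using (_≟_)

Cube : ℕ → Set
Cube d = Vec Bool d

cube : (d : ℕ) → List (Cube d)
cube zero = L._∷_ [] L.[]
cube (suc d) = concatMap (λ x → L._∷_ (false ∷ x) (L._∷_ (true ∷ x) L.[])) (cube d)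

weight : ∀ {n} → Vec Bool n → ℕ
weight [] = 0
weight (true ∷ xs) = suc (weight xs)
weight (false ∷ xs) = weight xs

hamming : ∀ {n} → Vec Bool n → Vec Bool n → ℕ
hamming x y = weight (zipWith _xor_ x y)

evenᵇ : ℕ → Bool
evenᵇ zero = true
evenᵇ (suc n) = not (evenᵇ n)

_==ᵇ_ : ℕ → ℕ → Bool
zero ==ᵇ zero = true
suc m ==ᵇ suc n = m ==ᵇ n
_ ==ᵇ _ = false

_≡ᵇ_ : Bool → Bool → Bool
a ≡ᵇ b = not (a xor b)

-- A component is specified by a
-- Boolean b: if k is odd, the component is the whole cube (b is irrelevant);
-- if k is even, it is the set of vertices whose weight has parity "even = b"
-- (b = true: even-weight vertices, b = false: odd-weight vertices).
inComp : ∀ {d} → (k : ℕ) → Bool → Cube d → Bool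
inComp k b x = if evenᵇ k then (evenᵇ (weight x) ≡ᵇ b) else true

compSize : (d k : ℕ) → Bool → ℕ
compSize d k b = length (filter (λ x → inComp k b x ≟ true) (cube d))

setSize : (d : ℕ) → (Cube d → Bool) → ℕ
setSize d A = length (filter (λ x → A x ≟ true) (cube d))

-- |E(A, V \ A)|: edges of the component (pairs at Hamming distance exactly k,
-- both endpoints in V) with exactly one endpoint in A. Each such edge is
-- counted once, via its endpoint x ∈ A and its endpoint y ∈ V \ A.
boundarySize : (d k : ℕ) → Bool → (Cube d → Bool) → ℕ
boundarySize d k b A =
  length (filter (λ p → cond p ≟ true) (concatMap (λ x → map (λ y → (x , y)) (cube d)) (cube d)))
  where
  open import Data.Product using (_×_; _,_)
  cond : Cube d × Cube d → Bool
  cond (x , y) = inComp k b x ∧ A x ∧ inComp k b y ∧ not (A y) ∧ (hamming x y ==ᵇ k)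

χ : ∀ {d} → Cube d → Cube d → ℤ
χ S x = if evenᵇ (weight (zipWith _∧_ S x)) then ℤ.+ 1 else ℤ.- (ℤ.+ 1)

toℤ : Bool → ℤ
toℤ true = + 1
toℤ false = + 0

sumℤ : List ℤ → ℤ
sumℤ = foldr ℤ._+_ (+ 0)

sumℚ : List ℚ → ℚ
sumℚ = foldr ℚ._+_ ℚ.0ℚ

fourier : (d : ℕ) → (Cube d → Bool) → Cube d → ℚ
fourier d f S = _/_ (sumℤ (map (λ x → toℤ (f x) ℤ.* χ S x) (cube d))) (2 ^ d) {{m^n≢0 2 d}}

fourierWeight : (d : ℕ) → (Cube d → Bool) → (Cube d → Bool) → ℚ
fourierWeight d f P = sumℚ (map (λ S → fourier d f S ℚ.* fourier d f S) (filter (λ S → P S ≟ true) (cube d)))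

ℕtoℚ : ℕ → ℚ
ℕtoℚ n = (+ n) / 1

module Submission where

-- Let f be the indicator of A, α = |A|/2^d = ∑_S f̂(S)², c = C(d-1,k-1), and K_k the Krawtchouk
-- polynomial. Expanding the edge count in characters gives |E(A,V∖A)| = 2^d ∑_S f̂(S)² (C(d,k) - K_k(S)).
-- The factor C(d,k) - K_k(S) depends only on |S|: it is 0 at |S| = 0 (and at |S| = d when k is even,
-- where f̂([d])² = f̂(∅)² = α² because A lies in one parity class), it is 2c at |S| = 1 (and at
-- |S| = d-1 when k is even), and it is at least 3c for every other S once d ≥ 11k + 4. So
-- |E| ≥ 2^d c (2α - 2α² + W), with 4α² when k is even, where W is the Fourier weight to be bounded.
-- Together with |E| ≤ (1+ε) c |A| and α ≤ 1/2 (α ≤ 1/4 when k is even) this gives W ≤ εα ≤ ε/2.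

module ListSum where

  open import Defs using (sumℤ; toℤ)
  open import Data.Bool using (Bool; true; false)
  open import Data.Integer using (ℤ; +_; _+_; _*_; _≤_; 0ℤ; 1ℤ)
  open import Data.List using (List; []; _∷_; map; filter; length; concatMap; _++_)
  open import Data.Product using (_×_; _,_)
  open import Data.Integer.Tactic.RingSolver using (solve-∀)
  open import Relation.Nullary using (Dec; does)
  open import Relation.Unary using (Pred)
  open import Level using (0ℓ)
  open import Relation.Binary.PropositionalEquality
  import Data.Bool as Bool
  import Data.Integer.Properties as ℤₚ

  private variable
    A B : Set

  ∑ : List A → (A → ℤ) → ℤ
  ∑ xs f = sumℤ (map f xs)

  ∑-cong : ∀ (xs : List A) {f g : A → ℤ} → (∀ x → f x ≡ g x) → ∑ xs f ≡ ∑ xs g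
  ∑-cong []       f≡g = refl
  ∑-cong (x ∷ xs) f≡g = cong₂ _+_ (f≡g x) (∑-cong xs f≡g)

  ∑-distrib-+ : ∀ (xs : List A) (f g : A → ℤ) → ∑ xs (λ x → f x + g x) ≡ ∑ xs f + ∑ xs g
  ∑-distrib-+ []       f g = refl
  ∑-distrib-+ (x ∷ xs) f g =
    trans (cong (_+_ (f x + g x)) (∑-distrib-+ xs f g)) (interchange (f x) (g x) (∑ xs f) (∑ xs g))
    where
    interchange : ∀ a b c e → a + b + (c + e) ≡ a + c + (b + e)
    interchange = solve-∀

  ∑-distrib-+₄ : ∀ (xs : List A) (f g u v : A → ℤ) →
    ∑ xs (λ x → f x + g x + u x + v x) ≡ ∑ xs f + ∑ xs g + ∑ xs u + ∑ xs v
  ∑-distrib-+₄ xs f g u v =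
    trans (∑-distrib-+ xs _ v) (cong (_+ ∑ xs v) (trans (∑-distrib-+ xs _ u) (cong (_+ ∑ xs u) (∑-distrib-+ xs f g))))

  ∑-distribˡ-* : ∀ (xs : List A) (c : ℤ) (f : A → ℤ) → ∑ xs (λ x → c * f x) ≡ c * ∑ xs f
  ∑-distribˡ-* []       c f = sym (ℤₚ.*-zeroʳ c)
  ∑-distribˡ-* (x ∷ xs) c f =
    trans (cong (_+_ (c * f x)) (∑-distribˡ-* xs c f)) (sym (ℤₚ.*-distribˡ-+ c (f x) (∑ xs f)))

  ∑-zero : ∀ (xs : List A) → ∑ xs (λ _ → 0ℤ) ≡ 0ℤ
  ∑-zero []       = refl
  ∑-zero (x ∷ xs) = trans (ℤₚ.+-identityˡ _) (∑-zero xs)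

  ∑-mono-≤ : ∀ (xs : List A) {f g : A → ℤ} → (∀ x → f x ≤ g x) → ∑ xs f ≤ ∑ xs g
  ∑-mono-≤ []       f≤g = ℤₚ.≤-refl
  ∑-mono-≤ (x ∷ xs) f≤g = ℤₚ.+-mono-≤ (f≤g x) (∑-mono-≤ xs f≤g)

  ∑-++ : ∀ (xs ys : List A) (f : A → ℤ) → ∑ (xs ++ ys) f ≡ ∑ xs f + ∑ ys f
  ∑-++ []       ys f = sym (ℤₚ.+-identityˡ _)
  ∑-++ (x ∷ xs) ys f = trans (cong (_+_ (f x)) (∑-++ xs ys f)) (sym (ℤₚ.+-assoc (f x) _ _))

  ∑-map : ∀ (xs : List A) (h : A → B) (f : B → ℤ) → ∑ (map h xs) f ≡ ∑ xs (λ x → f (h x))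
  ∑-map []       h f = refl
  ∑-map (x ∷ xs) h f = cong (_+_ (f (h x))) (∑-map xs h f)

  ∑-pairs : ∀ (xs : List A) (ys : List B) (f : A × B → ℤ) →
    ∑ (concatMap (λ x → map (x ,_) ys) xs) f ≡ ∑ xs (λ x → ∑ ys (λ y → f (x , y)))
  ∑-pairs []       ys f = refl
  ∑-pairs (x ∷ xs) ys f =
    trans (∑-++ (map (x ,_) ys) _ f) (cong₂ _+_ (∑-map ys (x ,_) f) (∑-pairs xs ys f))

  length-filter : ∀ {P : Pred A 0ℓ} (P? : ∀ x → Dec (P x)) (xs : List A) →
    + length (filter P? xs) ≡ ∑ xs (λ x → toℤ (does (P? x)))
  length-filter P? []       = refl
  length-filter P? (x ∷ xs) with does (P? x)
  ... | true  = trans (ℤₚ.pos-+ 1 _) (cong (_+_ 1ℤ) (length-filter P? xs))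
  ... | false = trans (length-filter P? xs) (sym (ℤₚ.+-identityˡ _))

  toℤ-does-≟true : ∀ b → toℤ (does (b Bool.≟ true)) ≡ toℤ b
  toℤ-does-≟true true  = refl
  toℤ-does-≟true false = refl

  length-filter-true : ∀ (xs : List A) (P : A → Bool) →
    + length (filter (λ x → P x Bool.≟ true) xs) ≡ ∑ xs (λ x → toℤ (P x))
  length-filter-true xs P =
    trans (length-filter (λ x → P x Bool.≟ true) xs) (∑-cong xs (λ x → toℤ-does-≟true (P x)))

  ∑-filter-true : ∀ (xs : List A) (P : A → Bool) (f : A → ℤ) →
    ∑ (filter (λ x → P x Bool.≟ true) xs) f ≡ ∑ xs (λ x → f x * toℤ (P x))
  ∑-filter-true []       P f = refl
  ∑-filter-true (x ∷ xs) P f with P x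
  ... | true  = cong₂ _+_ (sym (ℤₚ.*-identityʳ (f x))) (∑-filter-true xs P f)
  ... | false = begin
    ∑ (filter (λ x → P x Bool.≟ true) xs) f      ≡⟨ ∑-filter-true xs P f ⟩
    ∑ xs (λ x → f x * toℤ (P x))                 ≡⟨ ℤₚ.+-identityˡ _ ⟨
    0ℤ + ∑ xs (λ x → f x * toℤ (P x))            ≡⟨ cong (_+ ∑ xs (λ x → f x * toℤ (P x))) (ℤₚ.*-zeroʳ (f x)) ⟨
    f x * 0ℤ + ∑ xs (λ x → f x * toℤ (P x))      ∎
    where open ≡-Reasoning

module Binomial where

  open import Data.Nat
  open import Data.Nat.Properties
  open import Data.Nat.Combinatorics using (_C_; nCk+nC[k+1]≡[n+1]C[k+1])
  open import Data.Nat.Tactic.RingSolver using (solve-∀)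
  open import Relation.Binary.PropositionalEquality

  binom : ℕ → ℕ → ℕ
  binom n       zero    = 1
  binom zero    (suc k) = 0
  binom (suc n) (suc k) = binom n k + binom n (suc k)

  binom≡C : ∀ n k → binom n k ≡ n C k
  binom≡C n       zero    = refl
  binom≡C zero    (suc k) = refl
  binom≡C (suc n) (suc k) =
    trans (cong₂ _+_ (binom≡C n k) (binom≡C n (suc k))) (nCk+nC[k+1]≡[n+1]C[k+1] n k)

  binom-pos : ∀ {n m} → m ≤ n → 1 ≤ binom n m
  binom-pos {n}     {zero}  _         = s≤s z≤n
  binom-pos {suc n} {suc m} (s≤s m≤n) = ≤-trans (binom-pos m≤n) (m≤m+n (binom n m) _)

  binom-mono : ∀ n m → binom n m ≤ binom (suc n) m
  binom-mono n zero    = ≤-refl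
  binom-mono n (suc m) = m≤n+m (binom n (suc m)) (binom n m)

  binom-1 : ∀ n → binom n 1 ≡ n
  binom-1 zero    = refl
  binom-1 (suc n) = cong suc (binom-1 n)

  binom-absorption : ∀ n k → suc k * binom n (suc k) + k * binom n k ≡ n * binom n k
  binom-absorption n       zero    = trans (cong (λ t → 1 * t + 0) (binom-1 n)) (trans (+-identityʳ _) (*-comm 1 n))
  binom-absorption zero    (suc k) = cong₂ _+_ (*-zeroʳ (2 + k)) (*-zeroʳ (suc k))
  binom-absorption (suc n) (suc j) = begin
    (2 + j) * (b + c) + (1 + j) * (a + b)                       ≡⟨ regroup a b c j ⟩
    (2 + j) * b + (1 + j) * a + ((2 + j) * c + (1 + j) * b)     ≡⟨ cong ((2 + j) * b + (1 + j) * a +_) (binom-absorption n (suc j)) ⟩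
    (2 + j) * b + (1 + j) * a + n * b                           ≡⟨ regroup′ a b j n ⟩
    b + a + n * b + ((1 + j) * b + j * a)                       ≡⟨ cong (b + a + n * b +_) (binom-absorption n j) ⟩
    b + a + n * b + n * a                                       ≡⟨ regroup″ a b n ⟩
    (1 + n) * (a + b)                                           ∎
    where
    open ≡-Reasoning
    a = binom n j
    b = binom n (suc j)
    c = binom n (suc (suc j))
    regroup : ∀ a b c j → (2 + j) * (b + c) + (1 + j) * (a + b) ≡ (2 + j) * b + (1 + j) * a + ((2 + j) * c + (1 + j) * b)
    regroup = solve-∀
    regroup′ : ∀ a b j n → (2 + j) * b + (1 + j) * a + n * b ≡ b + a + n * b + ((1 + j) * b + j * a)
    regroup′ = solve-∀
    regroup″ : ∀ a b n → b + a + n * b + n * a ≡ (1 + n) * (a + b)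
    regroup″ = solve-∀

  binom-ratio : ∀ n j → 11 * suc j ≤ suc n → 10 * binom n j ≤ binom n (suc j)
  binom-ratio n j 11[j+1]≤n+1 = *-cancelˡ-≤ (suc j) (+-cancelʳ-≤ (j * a) _ _ (begin
    suc j * (10 * a) + j * a         ≡⟨ expand j a ⟩
    (11 * j + 10) * a                ≤⟨ *-monoˡ-≤ a 11j+10≤n ⟩
    n * a                            ≡⟨ binom-absorption n j ⟨
    suc j * binom n (suc j) + j * a  ∎))
    where
    open ≤-Reasoning
    a = binom n j
    expand : ∀ j a → suc j * (10 * a) + j * a ≡ (11 * j + 10) * a
    expand = solve-∀
    11[j+1]≡1+[11j+10] : ∀ j → 11 * suc j ≡ suc (11 * j + 10)
    11[j+1]≡1+[11j+10] = solve-∀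
    11j+10≤n : 11 * j + 10 ≤ n
    11j+10≤n = s≤s⁻¹ (subst (_≤ suc n) (11[j+1]≡1+[11j+10] j) 11[j+1]≤n+1)

  binom-growth : ∀ x m → 11 * m ≤ suc x → 10 * binom (suc x) m ≤ 11 * binom x m
  binom-growth x zero    _ = m≤m+n 10 1
  binom-growth x (suc j) h = begin
    10 * (binom x j + binom x (suc j))        ≡⟨ *-distribˡ-+ 10 (binom x j) _ ⟩
    10 * binom x j + 10 * binom x (suc j)     ≤⟨ +-monoˡ-≤ (10 * binom x (suc j)) (binom-ratio x j h) ⟩
    binom x (suc j) + 10 * binom x (suc j)    ≡⟨⟩
    11 * binom x (suc j)                      ∎
    where open ≤-Reasoning

  -- Three steps of growth cost at most (11/10)³ < 4/3; this is where the constant 11 comes from.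
  binom-growth³ : ∀ x m → 11 * m ≤ suc x → 3 * binom (3 + x) m ≤ 4 * binom x m
  binom-growth³ x m h = *-cancelˡ-≤ 1000 (begin
    1000 * (3 * binom (3 + x) m)  ≡⟨ rescale 1000 3 300 10 (binom (3 + x) m) refl ⟩
    300 * (10 * binom (3 + x) m)  ≤⟨ *-monoʳ-≤ 300 (binom-growth (2 + x) m (≤-trans h (≤-trans (n≤1+n _) (n≤1+n _)))) ⟩
    300 * (11 * binom (2 + x) m)  ≡⟨ rescale 300 11 330 10 (binom (2 + x) m) refl ⟩
    330 * (10 * binom (2 + x) m)  ≤⟨ *-monoʳ-≤ 330 (binom-growth (1 + x) m (≤-trans h (n≤1+n _))) ⟩
    330 * (11 * binom (1 + x) m)  ≡⟨ rescale 330 11 363 10 (binom (1 + x) m) refl ⟩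
    363 * (10 * binom (1 + x) m)  ≤⟨ *-monoʳ-≤ 363 (binom-growth x m h) ⟩
    363 * (11 * binom x m)        ≡⟨ *-assoc 363 11 (binom x m) ⟨
    3993 * binom x m              ≤⟨ *-monoˡ-≤ (binom x m) (m≤m+n 3993 7) ⟩
    4000 * binom x m              ≡⟨ *-assoc 1000 4 (binom x m) ⟩
    1000 * (4 * binom x m)        ∎)
    where
    open ≤-Reasoning
    rescale : ∀ a b c e y → a * b ≡ c * e → a * (b * y) ≡ c * (e * y)
    rescale a b c e y ab≡ce = trans (sym (*-assoc a b y)) (trans (cong (_* y) ab≡ce) (*-assoc c e y))

module Fourier where

  open import Defs
  open import Data.Bool using (Bool; true; false; _∧_; not; _xor_; if_then_else_)
  open import Data.Nat using (ℕ; zero; suc; _^_)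
  open import Data.Integer using (ℤ; +_; -_; _+_; _*_; 0ℤ; 1ℤ; _-_)
  open import Data.Integer.Tactic.RingSolver using (solve-∀)
  open import Data.Vec using ([]; _∷_; zipWith)
  open import Relation.Binary.PropositionalEquality
  open import Data.Bool.Properties using (∧-zeroʳ; ∧-identityʳ; not-distribˡ-xor; not-distribʳ-xor)
  open import Data.List using (List; map; concatMap)
  open import Data.Product using (_,_)
  import Data.Integer.Properties as ℤₚ
  import Data.List as List
  open ListSum
  open Binomial using (binom)

  ∑-cube-suc : ∀ d (g : Cube (suc d) → ℤ) →
    ∑ (cube (suc d)) g ≡ ∑ (cube d) (λ x → g (false ∷ x) + g (true ∷ x))
  ∑-cube-suc d g = go (cube d)
    where
    go : ∀ xs → ∑ (List.concatMap (λ x → (false ∷ x) List.∷ (true ∷ x) List.∷ List.[]) xs) g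
              ≡ ∑ xs (λ x → g (false ∷ x) + g (true ∷ x))
    go List.[]         = refl
    go (x List.∷ xs) =
      trans (cong (λ t → g (false ∷ x) + (g (true ∷ x) + t)) (go xs)) (sym (ℤₚ.+-assoc (g (false ∷ x)) _ _))

  ∑-cube-one : ∀ d → ∑ (cube d) (λ _ → 1ℤ) ≡ + 2 ^ d
  ∑-cube-one zero    = refl
  ∑-cube-one (suc d) = begin
    ∑ (cube (suc d)) (λ _ → 1ℤ)      ≡⟨ ∑-cube-suc d _ ⟩
    ∑ (cube d) (λ _ → + 2 * 1ℤ)      ≡⟨ ∑-distribˡ-* (cube d) (+ 2) _ ⟩
    + 2 * ∑ (cube d) (λ _ → 1ℤ)      ≡⟨ cong (+ 2 *_) (∑-cube-one d) ⟩
    + 2 * + 2 ^ d                    ≡⟨ ℤₚ.pos-* 2 (2 ^ d) ⟨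
    + 2 ^ suc d                      ∎
    where open ≡-Reasoning

  sign : Bool → ℤ
  sign false = 1ℤ
  sign true  = - 1ℤ

  χ-∷ : ∀ {d} (b c : Bool) (S x : Cube d) → χ (b ∷ S) (c ∷ x) ≡ sign (b ∧ c) * χ S x
  χ-∷ false c     S x = sym (ℤₚ.*-identityˡ _)
  χ-∷ true  false S x = sym (ℤₚ.*-identityˡ _)
  χ-∷ true  true  S x with evenᵇ (weight (zipWith _∧_ S x))
  ... | true  = refl
  ... | false = refl

  -- Unnormalised Fourier transform: fourier d A S is walsh d (toℤ ∘ A) S / 2 ^ d.
  walsh : ∀ d → (Cube d → ℤ) → Cube d → ℤ
  walsh d g S = ∑ (cube d) (λ x → g x * χ S x)

  slice : ∀ {d} → Bool → (Cube (suc d) → ℤ) → Cube d → ℤ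
  slice b g x = g (b ∷ x)

  walsh-∷ : ∀ d (g : Cube (suc d) → ℤ) b S →
    walsh (suc d) g (b ∷ S) ≡ walsh d (slice false g) S + sign b * walsh d (slice true g) S
  walsh-∷ d g b S = begin
    walsh (suc d) g (b ∷ S)
      ≡⟨ ∑-cube-suc d _ ⟩
    ∑ (cube d) (λ x → g (false ∷ x) * χ (b ∷ S) (false ∷ x) + g (true ∷ x) * χ (b ∷ S) (true ∷ x))
      ≡⟨ ∑-cong (cube d) pointwise ⟩
    ∑ (cube d) (λ x → g (false ∷ x) * χ S x + sign b * (g (true ∷ x) * χ S x))
      ≡⟨ ∑-distrib-+ (cube d) _ _ ⟩
    walsh d (slice false g) S + ∑ (cube d) (λ x → sign b * (g (true ∷ x) * χ S x))
      ≡⟨ cong (_+_ (walsh d (slice false g) S)) (∑-distribˡ-* (cube d) (sign b) _) ⟩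
    walsh d (slice false g) S + sign b * walsh d (slice true g) S ∎
    where
    open ≡-Reasoning
    swap : ∀ a s c → a * (s * c) ≡ s * (a * c)
    swap = solve-∀
    pointwise : ∀ x → g (false ∷ x) * χ (b ∷ S) (false ∷ x) + g (true ∷ x) * χ (b ∷ S) (true ∷ x)
                    ≡ g (false ∷ x) * χ S x + sign b * (g (true ∷ x) * χ S x)
    pointwise x rewrite χ-∷ b false S x | χ-∷ b true S x | ∧-zeroʳ b
                      | ∧-identityʳ b =
      cong₂ _+_ (cong (g (false ∷ x) *_) (ℤₚ.*-identityˡ (χ S x))) (swap (g (true ∷ x)) (sign b) (χ S x))

  double-∑-cube : ∀ d (f : Cube (suc d) → ℤ) →
    + 2 * (+ 2 ^ d * ∑ (cube d) (slice false f) + + 2 ^ d * ∑ (cube d) (slice true f))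
      ≡ + 2 ^ suc d * ∑ (cube (suc d)) f
  double-∑-cube d f = begin
    + 2 * (+ 2 ^ d * ∑ (cube d) (slice false f) + + 2 ^ d * ∑ (cube d) (slice true f))
      ≡⟨ factor (+ 2) (+ 2 ^ d) _ _ ⟩
    + 2 * + 2 ^ d * (∑ (cube d) (slice false f) + ∑ (cube d) (slice true f))
      ≡⟨ cong₂ _*_ (ℤₚ.pos-* 2 (2 ^ d)) (∑-distrib-+ (cube d) _ _) ⟨
    + 2 ^ suc d * ∑ (cube d) (λ x → f (false ∷ x) + f (true ∷ x))
      ≡⟨ cong (+ 2 ^ suc d *_) (∑-cube-suc d f) ⟨
    + 2 ^ suc d * ∑ (cube (suc d)) f ∎
    where
    open ≡-Reasoning
    factor : ∀ a b x y → a * (b * x + b * y) ≡ a * b * (x + y)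
    factor = solve-∀

  plancherel : ∀ d (g h : Cube d → ℤ) →
    ∑ (cube d) (λ S → walsh d g S * walsh d h S) ≡ + 2 ^ d * ∑ (cube d) (λ x → g x * h x)
  plancherel zero    g h = base (g []) (h [])
    where
    base : ∀ a b → (a * 1ℤ + 0ℤ) * (b * 1ℤ + 0ℤ) + 0ℤ ≡ 1ℤ * (a * b + 0ℤ)
    base = solve-∀
  plancherel (suc d) g h = begin
    ∑ (cube (suc d)) (λ S → walsh (suc d) g S * walsh (suc d) h S)
      ≡⟨ ∑-cube-suc d _ ⟩
    ∑ (cube d) (λ S → walsh (suc d) g (false ∷ S) * walsh (suc d) h (false ∷ S)
                    + walsh (suc d) g (true ∷ S) * walsh (suc d) h (true ∷ S))
      ≡⟨ ∑-cong (cube d) pointwise ⟩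
    ∑ (cube d) (λ S → + 2 * (G₀ S * H₀ S + G₁ S * H₁ S))
      ≡⟨ ∑-distribˡ-* (cube d) (+ 2) _ ⟩
    + 2 * ∑ (cube d) (λ S → G₀ S * H₀ S + G₁ S * H₁ S)
      ≡⟨ cong (+ 2 *_) (∑-distrib-+ (cube d) _ _) ⟩
    + 2 * (∑ (cube d) (λ S → G₀ S * H₀ S) + ∑ (cube d) (λ S → G₁ S * H₁ S))
      ≡⟨ cong (+ 2 *_) (cong₂ _+_ (plancherel d (slice false g) (slice false h))
                                  (plancherel d (slice true g) (slice true h))) ⟩
    + 2 * (+ 2 ^ d * ∑ (cube d) (λ x → g (false ∷ x) * h (false ∷ x))
         + + 2 ^ d * ∑ (cube d) (λ x → g (true ∷ x) * h (true ∷ x)))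
      ≡⟨ double-∑-cube d (λ x → g x * h x) ⟩
    + 2 ^ suc d * ∑ (cube (suc d)) (λ x → g x * h x) ∎
    where
    open ≡-Reasoning
    G₀ = walsh d (slice false g)
    G₁ = walsh d (slice true g)
    H₀ = walsh d (slice false h)
    H₁ = walsh d (slice true h)
    identity : ∀ g₀ g₁ h₀ h₁ → (g₀ + 1ℤ * g₁) * (h₀ + 1ℤ * h₁) + (g₀ + - 1ℤ * g₁) * (h₀ + - 1ℤ * h₁)
                            ≡ + 2 * (g₀ * h₀ + g₁ * h₁)
    identity = solve-∀
    pointwise : ∀ S → walsh (suc d) g (false ∷ S) * walsh (suc d) h (false ∷ S)
                    + walsh (suc d) g (true ∷ S) * walsh (suc d) h (true ∷ S)
                    ≡ + 2 * (G₀ S * H₀ S + G₁ S * H₁ S)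
    pointwise S rewrite walsh-∷ d g false S | walsh-∷ d g true S | walsh-∷ d h false S | walsh-∷ d h true S =
      identity (G₀ S) (G₁ S) (H₀ S) (H₁ S)

  -- krawtchouk S k = ∑_{|x| = k} χ S x, by recursion on the first coordinate of S.
  krawtchouk : ∀ {d} → Cube d → ℕ → ℤ
  krawtchouk []      zero    = 1ℤ
  krawtchouk []      (suc k) = 0ℤ
  krawtchouk (b ∷ S) zero    = 1ℤ
  krawtchouk (b ∷ S) (suc k) = krawtchouk S (suc k) + sign b * krawtchouk S k

  krawtchouk-zero : ∀ {d} (S : Cube d) → krawtchouk S zero ≡ 1ℤ
  krawtchouk-zero []      = refl
  krawtchouk-zero (b ∷ S) = refl

  δ : ℕ → ℕ → ℤ
  δ m n = toℤ (m ==ᵇ n)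

  distancePairing : ∀ d → ℕ → (Cube d → ℤ) → (Cube d → ℤ) → ℤ
  distancePairing d k g h = ∑ (cube d) (λ x → ∑ (cube d) (λ y → δ (hamming x y) k * (g x * h y)))

  distancePairing-split : ∀ d k (g h : Cube (suc d) → ℤ) → distancePairing (suc d) k g h ≡
      distancePairing d k (slice false g) (slice false h)
    + ∑ (cube d) (λ x → ∑ (cube d) (λ y → δ (suc (hamming x y)) k * (g (false ∷ x) * h (true ∷ y))))
    + ∑ (cube d) (λ x → ∑ (cube d) (λ y → δ (suc (hamming x y)) k * (g (true ∷ x) * h (false ∷ y))))
    + distancePairing d k (slice true g) (slice true h)
  distancePairing-split d k g h =
    trans (∑-cube-suc d _) (trans (∑-cong (cube d) (λ x → cong₂ _+_ (∑-cube-suc d _) (∑-cube-suc d _)))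
          (∑-∑-distrib-+₄ (cube d) _ _ _ _))
    where
    ∑-∑-distrib-+₄ : ∀ {A : Set} (xs : List A) (f g u v : A → A → ℤ) →
      ∑ xs (λ x → ∑ xs (λ y → f x y + g x y) + ∑ xs (λ y → u x y + v x y))
        ≡ ∑ xs (λ x → ∑ xs (f x)) + ∑ xs (λ x → ∑ xs (g x)) + ∑ xs (λ x → ∑ xs (u x)) + ∑ xs (λ x → ∑ xs (v x))
    ∑-∑-distrib-+₄ xs f g u v = begin
      ∑ xs (λ x → ∑ xs (λ y → f x y + g x y) + ∑ xs (λ y → u x y + v x y))
        ≡⟨ ∑-cong xs (λ x → cong₂ _+_ (∑-distrib-+ xs (f x) (g x)) (∑-distrib-+ xs (u x) (v x))) ⟩
      ∑ xs (λ x → (∑ xs (f x) + ∑ xs (g x)) + (∑ xs (u x) + ∑ xs (v x)))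
        ≡⟨ ∑-distrib-+ xs _ _ ⟩
      ∑ xs (λ x → ∑ xs (f x) + ∑ xs (g x)) + ∑ xs (λ x → ∑ xs (u x) + ∑ xs (v x))
        ≡⟨ cong₂ _+_ (∑-distrib-+ xs _ _) (∑-distrib-+ xs _ _) ⟩
      ∑ xs (λ x → ∑ xs (f x)) + ∑ xs (λ x → ∑ xs (g x)) + (∑ xs (λ x → ∑ xs (u x)) + ∑ xs (λ x → ∑ xs (v x)))
        ≡⟨ ℤₚ.+-assoc (∑ xs (λ x → ∑ xs (f x)) + ∑ xs (λ x → ∑ xs (g x))) _ _ ⟨
      ∑ xs (λ x → ∑ xs (f x)) + ∑ xs (λ x → ∑ xs (g x)) + ∑ xs (λ x → ∑ xs (u x)) + ∑ xs (λ x → ∑ xs (v x)) ∎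
      where open ≡-Reasoning

  distancePairing-split-suc : ∀ d k (g h : Cube (suc d) → ℤ) → distancePairing (suc d) (suc k) g h ≡
      distancePairing d (suc k) (slice false g) (slice false h) + distancePairing d k (slice false g) (slice true h)
    + distancePairing d k (slice true g) (slice false h) + distancePairing d (suc k) (slice true g) (slice true h)
  distancePairing-split-suc d k = distancePairing-split d (suc k)

  distancePairing-split-zero : ∀ d (g h : Cube (suc d) → ℤ) → distancePairing (suc d) zero g h ≡
      distancePairing d zero (slice false g) (slice false h) + distancePairing d zero (slice true g) (slice true h)
  distancePairing-split-zero d g h =
    trans (distancePairing-split d zero g h)
          (trans (cong₂ (λ s t → distancePairing d zero (slice false g) (slice false h) + s + t
                                  + distancePairing d zero (slice true g) (slice true h))
                        (no-cross (λ x y → g (false ∷ x) * h (true ∷ y)))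
                        (no-cross (λ x y → g (true ∷ x) * h (false ∷ y))))
                 (drop-zeros (distancePairing d zero (slice false g) (slice false h)) (distancePairing d zero (slice true g) (slice true h))))
    where
    no-cross : ∀ (f : Cube d → Cube d → ℤ) → ∑ (cube d) (λ x → ∑ (cube d) (λ y → 0ℤ * f x y)) ≡ 0ℤ
    no-cross f = trans (∑-cong (cube d) (λ x → trans (∑-cong (cube d) (λ y → ℤₚ.*-zeroˡ (f x y))) (∑-zero (cube d))))
                       (∑-zero (cube d))
    drop-zeros : ∀ a b → a + 0ℤ + 0ℤ + b ≡ a + b
    drop-zeros = solve-∀

  distancePairing-zero : ∀ d (g h : Cube d → ℤ) → distancePairing d zero g h ≡ ∑ (cube d) (λ x → g x * h x)
  distancePairing-zero zero    g h = base (g []) (h [])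
    where
    base : ∀ a b → 1ℤ * (a * b) + 0ℤ + 0ℤ ≡ a * b + 0ℤ
    base = solve-∀
  distancePairing-zero (suc d) g h = begin
    distancePairing (suc d) zero g h
      ≡⟨ distancePairing-split-zero d g h ⟩
    distancePairing d zero (slice false g) (slice false h) + distancePairing d zero (slice true g) (slice true h)
      ≡⟨ cong₂ _+_ (distancePairing-zero d (slice false g) (slice false h))
                   (distancePairing-zero d (slice true g) (slice true h)) ⟩
    ∑ (cube d) (λ x → g (false ∷ x) * h (false ∷ x)) + ∑ (cube d) (λ x → g (true ∷ x) * h (true ∷ x))
      ≡⟨ ∑-distrib-+ (cube d) _ _ ⟨
    ∑ (cube d) (λ x → g (false ∷ x) * h (false ∷ x) + g (true ∷ x) * h (true ∷ x))
      ≡⟨ ∑-cube-suc d _ ⟨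
    ∑ (cube (suc d)) (λ x → g x * h x) ∎
    where open ≡-Reasoning

  krawtchouk-walsh : ∀ d k (g h : Cube d → ℤ) →
    ∑ (cube d) (λ S → walsh d g S * walsh d h S * krawtchouk S k) ≡ + 2 ^ d * distancePairing d k g h
  krawtchouk-walsh d zero g h = begin
    ∑ (cube d) (λ S → walsh d g S * walsh d h S * krawtchouk S zero)
      ≡⟨ ∑-cong (cube d) (λ S → trans (cong (walsh d g S * walsh d h S *_) (krawtchouk-zero S)) (ℤₚ.*-identityʳ _)) ⟩
    ∑ (cube d) (λ S → walsh d g S * walsh d h S)
      ≡⟨ plancherel d g h ⟩
    + 2 ^ d * ∑ (cube d) (λ x → g x * h x)
      ≡⟨ cong (+ 2 ^ d *_) (distancePairing-zero d g h) ⟨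
    + 2 ^ d * distancePairing d zero g h ∎
    where open ≡-Reasoning
  krawtchouk-walsh zero (suc k) g h = base (g []) (h [])
    where
    base : ∀ a b → (a * 1ℤ + 0ℤ) * (b * 1ℤ + 0ℤ) * 0ℤ + 0ℤ ≡ 1ℤ * (0ℤ * (a * b) + 0ℤ + 0ℤ)
    base = solve-∀
  krawtchouk-walsh (suc d) (suc k) g h = begin
    ∑ (cube (suc d)) (λ S → walsh (suc d) g S * walsh (suc d) h S * krawtchouk S (suc k))
      ≡⟨ ∑-cube-suc d _ ⟩
    ∑ (cube d) (λ S → walsh (suc d) g (false ∷ S) * walsh (suc d) h (false ∷ S) * krawtchouk (false ∷ S) (suc k)
                    + walsh (suc d) g (true ∷ S) * walsh (suc d) h (true ∷ S) * krawtchouk (true ∷ S) (suc k))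
      ≡⟨ ∑-cong (cube d) pointwise ⟩
    ∑ (cube d) (λ S → + 2 * (T₀₀ S + T₀₁ S + T₁₀ S + T₁₁ S))
      ≡⟨ ∑-distribˡ-* (cube d) (+ 2) _ ⟩
    + 2 * ∑ (cube d) (λ S → T₀₀ S + T₀₁ S + T₁₀ S + T₁₁ S)
      ≡⟨ cong (+ 2 *_) (∑-distrib-+₄ (cube d) T₀₀ T₀₁ T₁₀ T₁₁) ⟩
    + 2 * (∑ (cube d) T₀₀ + ∑ (cube d) T₀₁ + ∑ (cube d) T₁₀ + ∑ (cube d) T₁₁)
      ≡⟨ cong (+ 2 *_) (cong₂ _+_ (cong₂ _+_ (cong₂ _+_
           (krawtchouk-walsh d (suc k) g₀ h₀) (krawtchouk-walsh d k g₀ h₁))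
           (krawtchouk-walsh d k g₁ h₀)) (krawtchouk-walsh d (suc k) g₁ h₁)) ⟩
    + 2 * (+ 2 ^ d * distancePairing d (suc k) g₀ h₀ + + 2 ^ d * distancePairing d k g₀ h₁
         + + 2 ^ d * distancePairing d k g₁ h₀ + + 2 ^ d * distancePairing d (suc k) g₁ h₁)
      ≡⟨ factor (+ 2) (+ 2 ^ d) _ _ _ _ ⟩
    + 2 * + 2 ^ d * (distancePairing d (suc k) g₀ h₀ + distancePairing d k g₀ h₁
                   + distancePairing d k g₁ h₀ + distancePairing d (suc k) g₁ h₁)
      ≡⟨ cong₂ _*_ (ℤₚ.pos-* 2 (2 ^ d)) (distancePairing-split-suc d k g h) ⟨
    + 2 ^ suc d * distancePairing (suc d) (suc k) g h ∎
    where
    open ≡-Reasoning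
    g₀ = slice false g
    g₁ = slice true g
    h₀ = slice false h
    h₁ = slice true h
    T₀₀ T₀₁ T₁₀ T₁₁ : Cube d → ℤ
    T₀₀ S = walsh d g₀ S * walsh d h₀ S * krawtchouk S (suc k)
    T₀₁ S = walsh d g₀ S * walsh d h₁ S * krawtchouk S k
    T₁₀ S = walsh d g₁ S * walsh d h₀ S * krawtchouk S k
    T₁₁ S = walsh d g₁ S * walsh d h₁ S * krawtchouk S (suc k)
    identity : ∀ a₀ a₁ b₀ b₁ c₀ c₁ →
        (a₀ + 1ℤ * a₁) * (b₀ + 1ℤ * b₁) * (c₁ + 1ℤ * c₀) + (a₀ + - 1ℤ * a₁) * (b₀ + - 1ℤ * b₁) * (c₁ + - 1ℤ * c₀)
      ≡ + 2 * (a₀ * b₀ * c₁ + a₀ * b₁ * c₀ + a₁ * b₀ * c₀ + a₁ * b₁ * c₁)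
    identity = solve-∀
    pointwise : ∀ S → walsh (suc d) g (false ∷ S) * walsh (suc d) h (false ∷ S) * krawtchouk (false ∷ S) (suc k)
                    + walsh (suc d) g (true ∷ S) * walsh (suc d) h (true ∷ S) * krawtchouk (true ∷ S) (suc k)
                    ≡ + 2 * (T₀₀ S + T₀₁ S + T₁₀ S + T₁₁ S)
    pointwise S rewrite walsh-∷ d g false S | walsh-∷ d g true S | walsh-∷ d h false S | walsh-∷ d h true S =
      identity (walsh d g₀ S) (walsh d g₁ S) (walsh d h₀ S) (walsh d h₁ S) (krawtchouk S k) (krawtchouk S (suc k))
    factor : ∀ a b w x y z → a * (b * w + b * x + b * y + b * z) ≡ a * b * (w + x + y + z)
    factor = solve-∀

  distancePairing-const : ∀ d k (g : Cube d → ℤ) →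
    distancePairing d k g (λ _ → 1ℤ) ≡ + binom d k * ∑ (cube d) g
  distancePairing-const d zero g =
    trans (distancePairing-zero d g _) (trans (∑-cong (cube d) (λ x → ℤₚ.*-identityʳ (g x))) (sym (ℤₚ.*-identityˡ _)))
  distancePairing-const zero (suc k) g = base (g [])
    where
    base : ∀ a → 0ℤ * (a * 1ℤ) + 0ℤ + 0ℤ ≡ 0ℤ * (a + 0ℤ)
    base = solve-∀
  distancePairing-const (suc d) (suc k) g = begin
    distancePairing (suc d) (suc k) g (λ _ → 1ℤ)
      ≡⟨ distancePairing-split-suc d k g _ ⟩
    distancePairing d (suc k) g₀ _ + distancePairing d k g₀ _ + distancePairing d k g₁ _ + distancePairing d (suc k) g₁ _
      ≡⟨ cong₂ _+_ (cong₂ _+_ (cong₂ _+_ (distancePairing-const d (suc k) g₀) (distancePairing-const d k g₀))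
                              (distancePairing-const d k g₁)) (distancePairing-const d (suc k) g₁) ⟩
    + b′ * ∑ (cube d) g₀ + + b * ∑ (cube d) g₀ + + b * ∑ (cube d) g₁ + + b′ * ∑ (cube d) g₁
      ≡⟨ factor (+ b) (+ b′) (∑ (cube d) g₀) (∑ (cube d) g₁) ⟩
    (+ b + + b′) * (∑ (cube d) g₀ + ∑ (cube d) g₁)
      ≡⟨ cong₂ _*_ (ℤₚ.pos-+ b b′) (∑-distrib-+ (cube d) g₀ g₁) ⟨
    + binom (suc d) (suc k) * ∑ (cube d) (λ x → g (false ∷ x) + g (true ∷ x))
      ≡⟨ cong (+ binom (suc d) (suc k) *_) (∑-cube-suc d g) ⟨
    + binom (suc d) (suc k) * ∑ (cube (suc d)) g ∎
    where
    open ≡-Reasoning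
    g₀ = slice false g
    g₁ = slice true g
    b = binom d k
    b′ = binom d (suc k)
    factor : ∀ b b′ x y → b′ * x + b * x + b * y + b′ * y ≡ (b + b′) * (x + y)
    factor = solve-∀

  distancePairing-linearʳ : ∀ d k (g h h′ : Cube d → ℤ) →
    distancePairing d k g h + distancePairing d k g h′ ≡ distancePairing d k g (λ y → h y + h′ y)
  distancePairing-linearʳ d k g h h′ =
    trans (sym (∑-distrib-+ (cube d) _ _))
          (∑-cong (cube d) (λ x → trans (sym (∑-distrib-+ (cube d) _ _))
                                        (∑-cong (cube d) (λ y → distrib (δ (hamming x y) k) (g x) (h y) (h′ y)))))
    where
    distrib : ∀ a b c e → a * (b * c) + a * (b * e) ≡ a * (b * (c + e))
    distrib = solve-∀

  distancePairing-congʳ : ∀ d k (g : Cube d → ℤ) {h h′ : Cube d → ℤ} → (∀ y → h y ≡ h′ y) →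
    distancePairing d k g h ≡ distancePairing d k g h′
  distancePairing-congʳ d k g h≡h′ =
    ∑-cong (cube d) (λ x → ∑-cong (cube d) (λ y → cong (λ t → δ (hamming x y) k * (g x * t)) (h≡h′ y)))

  evenᵇ-hamming : ∀ {d} (x y : Cube d) → evenᵇ (hamming x y) ≡ (evenᵇ (weight x) ≡ᵇ evenᵇ (weight y))
  evenᵇ-hamming []          []          = refl
  evenᵇ-hamming (false ∷ x) (false ∷ y) = evenᵇ-hamming x y
  evenᵇ-hamming (false ∷ x) (true ∷ y)  =
    cong not (trans (evenᵇ-hamming x y) (not-distribʳ-xor (evenᵇ (weight x)) (evenᵇ (weight y))))
  evenᵇ-hamming (true ∷ x)  (false ∷ y) =
    cong not (trans (evenᵇ-hamming x y) (not-distribˡ-xor (evenᵇ (weight x)) (evenᵇ (weight y))))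
  evenᵇ-hamming (true ∷ x)  (true ∷ y)  =
    trans (evenᵇ-hamming x y) (cong not (xor-not-not (evenᵇ (weight x)) (evenᵇ (weight y))))
    where
    xor-not-not : ∀ p q → p xor q ≡ not p xor not q
    xor-not-not false false = refl
    xor-not-not false true  = refl
    xor-not-not true  false = refl
    xor-not-not true  true  = refl

  ==ᵇ⇒≡ : ∀ m n → (m ==ᵇ n) ≡ true → m ≡ n
  ==ᵇ⇒≡ zero    zero    _  = refl
  ==ᵇ⇒≡ (suc m) (suc n) eq = cong suc (==ᵇ⇒≡ m n eq)

  inComp-closed : ∀ {d} k b (x y : Cube d) →
    inComp k b x ≡ true → (hamming x y ==ᵇ k) ≡ true → inComp k b y ≡ true
  inComp-closed k b x y x∈V dist≡k with evenᵇ k in k-even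
  ... | false = refl
  ... | true  = same-parity (evenᵇ (weight x)) (evenᵇ (weight y)) b x∈V
    (trans (sym (evenᵇ-hamming x y)) (trans (cong evenᵇ (==ᵇ⇒≡ (hamming x y) k dist≡k)) k-even))
    where
    same-parity : ∀ p q b → (p ≡ᵇ b) ≡ true → (p ≡ᵇ q) ≡ true → (q ≡ᵇ b) ≡ true
    same-parity true  true  true  _ _ = refl
    same-parity false false false _ _ = refl
    same-parity true  true  false () _
    same-parity false false true  () _
    same-parity true  false _     _ ()
    same-parity false true  _     _ ()

  boundarySize≡distancePairing : ∀ d k b (A : Cube d → Bool) → (∀ x → A x ≡ true → inComp k b x ≡ true) →
    + boundarySize d k b A ≡ distancePairing d k (λ x → toℤ (A x)) (λ y → toℤ (not (A y)))
  boundarySize≡distancePairing d k b A A⊆V =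
    trans (length-filter _ (concatMap (λ x → map (x ,_) (cube d)) (cube d)))
    (trans (∑-pairs (cube d) (cube d) _)
           (∑-cong (cube d) (λ x → ∑-cong (cube d) (λ y → trans (toℤ-does-≟true _) (edge-term x y)))))
    where
    edge-term : ∀ x y →
      toℤ (inComp k b x ∧ A x ∧ inComp k b y ∧ not (A y) ∧ (hamming x y ==ᵇ k))
        ≡ δ (hamming x y) k * (toℤ (A x) * toℤ (not (A y)))
    edge-term x y with A x in Ax
    ... | false rewrite ∧-zeroʳ (inComp k b x) = sym (ℤₚ.*-zeroʳ (δ (hamming x y) k))
    ... | true rewrite A⊆V x Ax with hamming x y ==ᵇ k in dist≡k
    ...   | false rewrite ∧-zeroʳ (not (A y)) = cong toℤ (∧-zeroʳ (inComp k b y))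
    ...   | true  rewrite inComp-closed k b x y (A⊆V x Ax) dist≡k | ∧-identityʳ (not (A y)) =
      sym (trans (ℤₚ.*-identityˡ _) (ℤₚ.*-identityˡ _))

  toℤ-idem : ∀ b → toℤ b * toℤ b ≡ toℤ b
  toℤ-idem true  = refl
  toℤ-idem false = refl

  toℤ-+-not : ∀ b → toℤ b + toℤ (not b) ≡ 1ℤ
  toℤ-+-not true  = refl
  toℤ-+-not false = refl

  parseval-indicator : ∀ d (A : Cube d → Bool) →
    ∑ (cube d) (λ S → walsh d (λ x → toℤ (A x)) S * walsh d (λ x → toℤ (A x)) S)
      ≡ + 2 ^ d * ∑ (cube d) (λ x → toℤ (A x))
  parseval-indicator d A =
    trans (plancherel d (λ x → toℤ (A x)) (λ x → toℤ (A x))) (cong (+ 2 ^ d *_) (∑-cong (cube d) (λ x → toℤ-idem (A x))))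

  spectral-boundary : ∀ d k b (A : Cube d → Bool) → (∀ x → A x ≡ true → inComp k b x ≡ true) →
    ∑ (cube d) (λ S → walsh d (λ x → toℤ (A x)) S * walsh d (λ x → toℤ (A x)) S * (+ binom d k - krawtchouk S k))
      ≡ + 2 ^ d * + boundarySize d k b A
  spectral-boundary d k b A A⊆V = begin
    ∑ (cube d) (λ S → F S * F S * (+ binom d k - krawtchouk S k))
      ≡⟨ ∑-cong (cube d) (λ S → expand (F S) (+ binom d k) (krawtchouk S k)) ⟩
    ∑ (cube d) (λ S → + binom d k * (F S * F S) + - 1ℤ * (F S * F S * krawtchouk S k))
      ≡⟨ ∑-distrib-+ (cube d) _ _ ⟩
    ∑ (cube d) (λ S → + binom d k * (F S * F S)) + ∑ (cube d) (λ S → - 1ℤ * (F S * F S * krawtchouk S k))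
      ≡⟨ cong₂ _+_ (∑-distribˡ-* (cube d) (+ binom d k) (λ S → F S * F S))
                   (∑-distribˡ-* (cube d) (- 1ℤ) (λ S → F S * F S * krawtchouk S k)) ⟩
    + binom d k * ∑ (cube d) (λ S → F S * F S) + - 1ℤ * ∑ (cube d) (λ S → F S * F S * krawtchouk S k)
      ≡⟨ cong₂ (λ s t → + binom d k * s + - 1ℤ * t) (parseval-indicator d A) (krawtchouk-walsh d k f f) ⟩
    + binom d k * (U * ∑ (cube d) f) + - 1ℤ * (U * distancePairing d k f f)
      ≡⟨ cong (λ t → + binom d k * (U * ∑ (cube d) f) + - 1ℤ * (U * t)) inside ⟩
    + binom d k * (U * ∑ (cube d) f) + - 1ℤ * (U * (+ binom d k * ∑ (cube d) f - distancePairing d k f f∁))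
      ≡⟨ cancel (+ binom d k) U (∑ (cube d) f) (distancePairing d k f f∁) ⟩
    U * distancePairing d k f f∁
      ≡⟨ cong (U *_) (boundarySize≡distancePairing d k b A A⊆V) ⟨
    U * + boundarySize d k b A ∎
    where
    open ≡-Reasoning
    f f∁ : Cube d → ℤ
    f x = toℤ (A x)
    f∁ x = toℤ (not (A x))
    F = walsh d f
    U = + 2 ^ d
    expand : ∀ x b κ → x * x * (b - κ) ≡ b * (x * x) + - 1ℤ * (x * x * κ)
    expand = solve-∀
    cancel : ∀ b u s g → b * (u * s) + - 1ℤ * (u * (b * s - g)) ≡ u * g
    cancel = solve-∀
    split : distancePairing d k f f + distancePairing d k f f∁ ≡ + binom d k * ∑ (cube d) f
    split = trans (distancePairing-linearʳ d k f f f∁)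
      (trans (distancePairing-congʳ d k f (λ y → toℤ-+-not (A y))) (distancePairing-const d k f))
    add-sub : ∀ a c → a + c - c ≡ a
    add-sub = solve-∀
    inside : distancePairing d k f f ≡ + binom d k * ∑ (cube d) f - distancePairing d k f f∁
    inside = sym (trans (cong (_- distancePairing d k f f∁) (sym split))
                        (add-sub (distancePairing d k f f) (distancePairing d k f f∁)))

module Krawtchouk where

  open import Defs
  open import Data.Bool using (Bool; true; false; if_then_else_; not; _∧_; T)
  open import Data.Nat using (ℕ; zero; suc; _≤ᵇ_; _∸_)
  open import Data.Integer using (ℤ; +_; -_; _+_; _*_; _-_; _≤_; 0ℤ; 1ℤ; -≤+; +≤+)
  open import Data.Integer.Tactic.RingSolver using (solve-∀)
  open import Data.Product using (Σ; _×_; _,_; proj₁; proj₂)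
  open import Data.Vec using ([]; _∷_; replicate)
  open import Data.Empty using (⊥-elim)
  open import Relation.Binary.PropositionalEquality
  open import Data.Bool.Properties using (not-injective)
  open import Data.Unit using (tt)
  open import Data.Sum using (_⊎_; inj₁; inj₂)
  open import Relation.Nullary using (¬_; yes; no)
  import Data.Nat as ℕ
  import Data.Nat.Properties as ℕₚ
  import Data.Integer.Properties as ℤₚ
  open Fourier using (krawtchouk; krawtchouk-zero; sign; δ)
  open Binomial

  krawtchouk-bounded : ∀ {d} (S : Cube d) k → - + binom d k ≤ krawtchouk S k × krawtchouk S k ≤ + binom d k
  krawtchouk-bounded []      zero    = -≤+ , ℤₚ.≤-refl
  krawtchouk-bounded []      (suc k) = ℤₚ.≤-refl , ℤₚ.≤-refl
  krawtchouk-bounded (b ∷ S) zero    = -≤+ , ℤₚ.≤-refl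
  krawtchouk-bounded {suc d} (b ∷ S) (suc k) = lower , upper
    where
    binom-suc : + binom (suc d) (suc k) ≡ + binom d (suc k) + + binom d k
    binom-suc = trans (ℤₚ.pos-+ (binom d k) (binom d (suc k))) (ℤₚ.+-comm (+ binom d k) (+ binom d (suc k)))
    sign-bounded : ∀ b {x c} → - c ≤ x → x ≤ c → - c ≤ sign b * x × sign b * x ≤ c
    sign-bounded false {x} lo hi rewrite ℤₚ.*-identityˡ x = lo , hi
    sign-bounded true  {x} {c} lo hi rewrite ℤₚ.-1*i≡-i x =
      ℤₚ.neg-mono-≤ hi , subst (- x ≤_) (ℤₚ.neg-involutive c) (ℤₚ.neg-mono-≤ lo)
    IH₁ = krawtchouk-bounded S (suc k)
    IH₂ = krawtchouk-bounded S k
    bounds = sign-bounded b (proj₁ IH₂) (proj₂ IH₂)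
    upper : krawtchouk S (suc k) + sign b * krawtchouk S k ≤ + binom (suc d) (suc k)
    upper = subst (krawtchouk S (suc k) + sign b * krawtchouk S k ≤_) (sym binom-suc) (ℤₚ.+-mono-≤ (proj₂ IH₁) (proj₂ bounds))
    lower : - + binom (suc d) (suc k) ≤ krawtchouk S (suc k) + sign b * krawtchouk S k
    lower = subst (_≤ krawtchouk S (suc k) + sign b * krawtchouk S k) (sym (trans (cong -_ binom-suc) (ℤₚ.neg-distrib-+ (+ binom d (suc k)) _)))
                  (ℤₚ.+-mono-≤ (proj₁ IH₁) (proj₁ bounds))

  infix 4 _≈ₖ_
  _≈ₖ_ : ∀ {d} → Cube d → Cube d → Set
  S ≈ₖ S′ = ∀ k → krawtchouk S k ≡ krawtchouk S′ k

  ≈ₖ-∷ : ∀ {d} b {S S′ : Cube d} → S ≈ₖ S′ → b ∷ S ≈ₖ b ∷ S′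
  ≈ₖ-∷ b S≈S′ zero    = refl
  ≈ₖ-∷ b S≈S′ (suc k) = cong₂ (λ u v → u + sign b * v) (S≈S′ (suc k)) (S≈S′ k)

  ≈ₖ-swap : ∀ {d} a b (S : Cube d) → a ∷ b ∷ S ≈ₖ b ∷ a ∷ S
  ≈ₖ-swap a b S zero          = refl
  ≈ₖ-swap a b S (suc zero)    rewrite krawtchouk-zero S = swap₁ (krawtchouk S 1) (sign a) (sign b)
    where
    swap₁ : ∀ x p q → x + q * 1ℤ + p * 1ℤ ≡ x + p * 1ℤ + q * 1ℤ
    swap₁ = solve-∀
  ≈ₖ-swap a b S (suc (suc k)) =
    swap₂ (krawtchouk S (suc (suc k))) (krawtchouk S (suc k)) (krawtchouk S k) (sign a) (sign b)
    where
    swap₂ : ∀ x y z p q → x + q * y + p * (y + q * z) ≡ x + p * y + q * (y + p * z)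
    swap₂ = solve-∀

  pull-true : ∀ {d} (S : Cube (suc d)) → 1 ℕ.≤ weight S →
    Σ (Cube d) λ S′ → S ≈ₖ true ∷ S′ × suc (weight S′) ≡ weight S
  pull-true         (true ∷ S)       _   = S , (λ _ → refl) , refl
  pull-true {zero}  (false ∷ [])     ()
  pull-true {suc d} (false ∷ S)      1≤w with pull-true S 1≤w
  ... | S′ , S≈ , w≡ = false ∷ S′ , (λ k → trans (≈ₖ-∷ false S≈ k) (≈ₖ-swap false true S′ k)) , w≡

  pull-false : ∀ {d} (S : Cube (suc d)) → weight S ℕ.≤ d →
    Σ (Cube d) λ S′ → S ≈ₖ false ∷ S′ × weight S′ ≡ weight S
  pull-false         (false ∷ S)     _         = S , (λ _ → refl) , refl
  pull-false {zero}  (true ∷ [])     ()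
  pull-false {suc d} (true ∷ S)      (ℕ.s≤s w≤d) with pull-false S w≤d
  ... | S′ , S≈ , w≡ = true ∷ S′ , (λ k → trans (≈ₖ-∷ true S≈ k) (≈ₖ-swap true false S′ k)) , cong suc w≡

  weight≤length : ∀ {d} (S : Cube d) → weight S ℕ.≤ d
  weight≤length []          = ℕ.z≤n
  weight≤length (true ∷ S)  = ℕ.s≤s (weight≤length S)
  weight≤length (false ∷ S) = ℕₚ.m≤n⇒m≤1+n (weight≤length S)

  weight≡0⇒all-false : ∀ {d} (S : Cube d) → weight S ≡ 0 → S ≡ replicate d false
  weight≡0⇒all-false []          _  = refl
  weight≡0⇒all-false (false ∷ S) w≡0 = cong (false ∷_) (weight≡0⇒all-false S w≡0)

  weight≡d⇒all-true : ∀ {d} (S : Cube d) → weight S ≡ d → S ≡ replicate d true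
  weight≡d⇒all-true         []          _   = refl
  weight≡d⇒all-true         (true ∷ S)  w≡d = cong (true ∷_) (weight≡d⇒all-true S (ℕₚ.suc-injective w≡d))
  weight≡d⇒all-true {suc d} (false ∷ S) w≡d =
    ⊥-elim (ℕₚ.1+n≰n (subst (ℕ._≤ d) w≡d (weight≤length S)))

  krawtchouk-all-false : ∀ n k → krawtchouk (replicate n false) k ≡ + binom n k
  krawtchouk-all-false zero    zero    = refl
  krawtchouk-all-false zero    (suc k) = refl
  krawtchouk-all-false (suc n) zero    = refl
  krawtchouk-all-false (suc n) (suc k) rewrite krawtchouk-all-false n (suc k) | krawtchouk-all-false n k =
    trans (cong (_+_ (+ binom n (suc k))) (ℤₚ.*-identityˡ (+ binom n k)))
          (trans (ℤₚ.+-comm (+ binom n (suc k)) (+ binom n k)) (sym (ℤₚ.pos-+ (binom n k) (binom n (suc k)))))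

  altSign : ℕ → ℤ
  altSign k = if evenᵇ k then 1ℤ else - 1ℤ

  krawtchouk-all-true : ∀ n k → krawtchouk (replicate n true) k ≡ altSign k * + binom n k
  krawtchouk-all-true zero    zero    = refl
  krawtchouk-all-true zero    (suc k) = sym (ℤₚ.*-zeroʳ (altSign (suc k)))
  krawtchouk-all-true (suc n) zero    = refl
  krawtchouk-all-true (suc n) (suc k)
    rewrite krawtchouk-all-true n (suc k) | krawtchouk-all-true n k | ℤₚ.pos-+ (binom n k) (binom n (suc k))
    with evenᵇ k
  ... | true  = alternate (+ binom n k) (+ binom n (suc k))
    where
    alternate : ∀ a b → - 1ℤ * b + - 1ℤ * (1ℤ * a) ≡ - 1ℤ * (a + b)
    alternate = solve-∀
  ... | false = alternate (+ binom n k) (+ binom n (suc k))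
    where
    alternate : ∀ a b → 1ℤ * b + - 1ℤ * (- 1ℤ * a) ≡ 1ℤ * (a + b)
    alternate = solve-∀

  -- Twice the number of x of weight k with |x ∩ S| odd.
  deficit : ∀ {d} → Cube d → ℕ → ℤ
  deficit {d} S k = + binom d k - krawtchouk S k

  deficit-nonneg : ∀ {d} (S : Cube d) k → 0ℤ ≤ deficit S k
  deficit-nonneg S k = ℤₚ.i≤j⇒0≤j-i (proj₂ (krawtchouk-bounded S k))

  deficit-cong : ∀ {d} (S S′ : Cube d) k → S ≈ₖ S′ → deficit S k ≡ deficit S′ k
  deficit-cong {d} S S′ k S≈S′ = cong (_-_ (+ binom d k)) (S≈S′ k)

  deficit-weight-zero : ∀ {d} (S : Cube d) k → weight S ≡ 0 → deficit S k ≡ 0ℤ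
  deficit-weight-zero {d} S k w≡0 rewrite weight≡0⇒all-false S w≡0 | krawtchouk-all-false d k =
    ℤₚ.+-inverseʳ (+ binom d k)

  binom-suc : ∀ n m → + binom (suc n) (suc m) ≡ + binom n m + + binom n (suc m)
  binom-suc n m = ℤₚ.pos-+ (binom n m) (binom n (suc m))

  deficit-true-all-false : ∀ n m → deficit (true ∷ replicate n false) (suc m) ≡ + 2 * + binom n m
  deficit-true-all-false n m
    rewrite krawtchouk-all-false n (suc m) | krawtchouk-all-false n m | binom-suc n m =
    identity (+ binom n m) (+ binom n (suc m))
    where
    identity : ∀ a b → a + b - (b + - 1ℤ * a) ≡ + 2 * a
    identity = solve-∀

  deficit-weight-one : ∀ {n} (S : Cube (suc n)) m → weight S ≡ 1 → deficit S (suc m) ≡ + 2 * + binom n m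
  deficit-weight-one {n} S m w≡1 with pull-true S (subst (1 ℕ.≤_) (sym w≡1) ℕₚ.≤-refl)
  ... | S′ , S≈ , w≡ = begin
    deficit S (suc m)                            ≡⟨ deficit-cong S (true ∷ S′) (suc m) S≈ ⟩
    deficit (true ∷ S′) (suc m)                  ≡⟨ cong (λ T → deficit (true ∷ T) (suc m)) S′≡0 ⟩
    deficit (true ∷ replicate n false) (suc m)   ≡⟨ deficit-true-all-false n m ⟩
    + 2 * + binom n m                            ∎
    where
    open ≡-Reasoning
    S′≡0 = weight≡0⇒all-false S′ (ℕₚ.suc-injective (trans w≡ w≡1))

  deficit-false-all-true : ∀ n m → deficit (false ∷ replicate n true) (suc m)
    ≡ + binom n m + + binom n (suc m) - (altSign (suc m) * + binom n (suc m) + altSign m * + binom n m)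
  deficit-false-all-true n m
    rewrite krawtchouk-all-true n (suc m) | krawtchouk-all-true n m | binom-suc n m =
    cong (λ t → + binom n m + + binom n (suc m) - (altSign (suc m) * + binom n (suc m) + t))
         (ℤₚ.*-identityˡ (altSign m * + binom n m))

  deficit-weight-n : ∀ {n} (S : Cube (suc n)) m → weight S ≡ n →
    deficit S (suc m) ≡ + binom n m + + binom n (suc m) - (altSign (suc m) * + binom n (suc m) + altSign m * + binom n m)
  deficit-weight-n {n} S m w≡n with pull-false S (subst (ℕ._≤ n) (sym w≡n) ℕₚ.≤-refl)
  ... | S′ , S≈ , w≡ =
    trans (deficit-cong S (false ∷ S′) (suc m) S≈)
          (trans (cong (λ T → deficit (false ∷ T) (suc m)) (weight≡d⇒all-true S′ (trans w≡ w≡n)))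
                 (deficit-false-all-true n m))

  deficit-all-true : ∀ n m →
    deficit (replicate (suc n) true) (suc m) ≡ + binom n m + + binom n (suc m) - altSign (suc m) * (+ binom n m + + binom n (suc m))
  deficit-all-true n m rewrite krawtchouk-all-true (suc n) (suc m) | binom-suc n m = refl

  deficit-true-false : ∀ {n} (Y : Cube n) m →
    deficit Y (suc m) + + 2 * + binom n m ≤ deficit (true ∷ false ∷ Y) (suc m)
  deficit-true-false {n} Y zero rewrite krawtchouk-zero Y | binom-suc (suc n) 0 | binom-suc n 0 =
    ℤₚ.≤-reflexive (identity (+ binom n 1) (krawtchouk Y 1))
    where
    identity : ∀ b κ → b - κ + + 2 * 1ℤ ≡ 1ℤ + (1ℤ + b) - (κ + 1ℤ * 1ℤ + - 1ℤ * 1ℤ)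
    identity = solve-∀
  deficit-true-false {n} Y (suc m)
    rewrite binom-suc (suc n) (suc m) | binom-suc n m | binom-suc n (suc m) = begin
    deficit Y (suc (suc m)) + + 2 * b₁                   ≡⟨ ℤₚ.+-identityʳ _ ⟨
    deficit Y (suc (suc m)) + + 2 * b₁ + 0ℤ              ≤⟨ ℤₚ.+-monoʳ-≤ (deficit Y (suc (suc m)) + + 2 * b₁) b₀+κ₀≥0 ⟩
    deficit Y (suc (suc m)) + + 2 * b₁ + (b₀ + κ₀)        ≡⟨ identity b₀ b₁ b₂ κ₂ κ₁ κ₀ ⟩
    (b₀ + b₁) + (b₁ + b₂) - (κ₂ + 1ℤ * κ₁ + - 1ℤ * (κ₁ + 1ℤ * κ₀)) ∎
    where
    open ℤₚ.≤-Reasoning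
    b₀ = + binom n m
    b₁ = + binom n (suc m)
    b₂ = + binom n (suc (suc m))
    κ₀ = krawtchouk Y m
    κ₁ = krawtchouk Y (suc m)
    κ₂ = krawtchouk Y (suc (suc m))
    b₀+κ₀≥0 : 0ℤ ≤ b₀ + κ₀
    b₀+κ₀≥0 = subst (_≤ b₀ + κ₀) (ℤₚ.+-inverseʳ b₀) (ℤₚ.+-monoʳ-≤ b₀ (proj₁ (krawtchouk-bounded Y m)))
    identity : ∀ b₀ b₁ b₂ κ₂ κ₁ κ₀ →
      b₂ - κ₂ + + 2 * b₁ + (b₀ + κ₀) ≡ (b₀ + b₁) + (b₁ + b₂) - (κ₂ + 1ℤ * κ₁ + - 1ℤ * (κ₁ + 1ℤ * κ₀))
    identity = solve-∀

  pull-true-false : ∀ {d} (S : Cube (2 ℕ.+ d)) → 1 ℕ.≤ weight S → weight S ℕ.≤ suc d →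
    Σ (Cube d) λ S′ → S ≈ₖ true ∷ false ∷ S′ × suc (weight S′) ≡ weight S
  pull-true-false S 1≤w w≤1+d with pull-true S 1≤w
  ... | S₁ , S≈ , w₁≡ with pull-false S₁ (ℕ.s≤s⁻¹ (subst (ℕ._≤ _) (sym w₁≡) w≤1+d))
  ... | S₂ , S₁≈ , w₂≡ = S₂ , (λ k → trans (S≈ k) (≈ₖ-∷ true S₁≈ k)) , trans (cong suc w₂≡) w₁≡

  deficit-middle : ∀ {n} (S : Cube (suc n)) m → 4 ℕ.+ 11 ℕ.* suc m ℕ.≤ suc n →
    2 ℕ.≤ weight S → 2 ℕ.+ weight S ℕ.≤ suc n → + 3 * + binom n m ≤ deficit S (suc m)
  deficit-middle {0}       S m (ℕ.s≤s ())
  deficit-middle {1}       S m (ℕ.s≤s (ℕ.s≤s ()))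
  deficit-middle {2}       S m (ℕ.s≤s (ℕ.s≤s (ℕ.s≤s ())))
  deficit-middle {suc (suc (suc n′))} S m (ℕ.s≤s (ℕ.s≤s (ℕ.s≤s (ℕ.s≤s 11[m+1]≤n′)))) 2≤w (ℕ.s≤s (ℕ.s≤s w≤2+n′))
    with pull-true-false S (ℕₚ.<⇒≤ 2≤w) (ℕₚ.m≤n⇒m≤1+n w≤2+n′)
  ... | S₁ , S≈ , w₁≡ with pull-true-false S₁ (ℕ.s≤s⁻¹ (subst (2 ℕ.≤_) (sym w₁≡) 2≤w))
                                               (ℕ.s≤s⁻¹ (subst (ℕ._≤ 2 ℕ.+ n′) (sym w₁≡) w≤2+n′))
  ... | X , S₁≈ , _ = begin
    + 3 * + binom (3 ℕ.+ n′) m                                   ≤⟨ three≤four ⟩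
    0ℤ + + 2 * + binom n′ m + + 2 * + binom n′ m                ≤⟨ ℤₚ.+-mono-≤ (ℤₚ.+-monoˡ-≤ (+ 2 * + binom n′ m) (deficit-nonneg X (suc m)))
                                                                     (ℤₚ.*-monoˡ-≤-nonNeg (+ 2) (+≤+ binom-mono²)) ⟩
    deficit X (suc m) + + 2 * + binom n′ m + + 2 * + binom (2 ℕ.+ n′) m
                                                                 ≤⟨ ℤₚ.+-monoˡ-≤ (+ 2 * + binom (2 ℕ.+ n′) m) (deficit-true-false X m) ⟩
    deficit (true ∷ false ∷ X) (suc m) + + 2 * + binom (2 ℕ.+ n′) m
                                                                 ≤⟨ deficit-true-false (true ∷ false ∷ X) m ⟩
    deficit (true ∷ false ∷ true ∷ false ∷ X) (suc m)            ≡⟨ deficit-cong S (true ∷ false ∷ true ∷ false ∷ X) (suc m) S≈′ ⟨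
    deficit S (suc m)                                            ∎
    where
    open ℤₚ.≤-Reasoning
    S≈′ : S ≈ₖ true ∷ false ∷ true ∷ false ∷ X
    S≈′ k = trans (S≈ k) (≈ₖ-∷ true (≈ₖ-∷ false S₁≈) k)
    binom-mono² : binom n′ m ℕ.≤ binom (2 ℕ.+ n′) m
    binom-mono² = ℕₚ.≤-trans (binom-mono n′ m) (binom-mono (suc n′) m)
    11m≤1+n′ : 11 ℕ.* m ℕ.≤ suc n′
    11m≤1+n′ = ℕₚ.≤-trans (ℕₚ.*-monoʳ-≤ 11 (ℕₚ.n≤1+n m)) (ℕₚ.≤-trans 11[m+1]≤n′ (ℕₚ.n≤1+n n′))
    four : ∀ a → + 4 * a ≡ 0ℤ + + 2 * a + + 2 * a
    four = solve-∀
    three≤four : + 3 * + binom (3 ℕ.+ n′) m ≤ 0ℤ + + 2 * + binom n′ m + + 2 * + binom n′ m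
    three≤four = subst₂ _≤_ (ℤₚ.pos-* 3 (binom (3 ℕ.+ n′) m)) (trans (ℤₚ.pos-* 4 (binom n′ m)) (four (+ binom n′ m)))
                        (+≤+ (binom-growth³ n′ m 11m≤1+n′))

  weight-high : ∀ {n} w → w ℕ.≤ suc n → ¬ (2 ℕ.+ w ℕ.≤ suc n) → suc w ≡ suc n ⊎ w ≡ suc n
  weight-high {n} w w≤1+n ¬2+w≤1+n with ℕₚ.m≤n⇒m<n∨m≡n w≤1+n
  ... | inj₂ w≡1+n = inj₂ w≡1+n
  ... | inj₁ w<1+n = inj₁ (ℕₚ.≤-antisym w<1+n (ℕ.s≤s⁻¹ (ℕₚ.≰⇒> ¬2+w≤1+n)))

  altSign-even : ∀ k → evenᵇ k ≡ true → altSign k ≡ 1ℤ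
  altSign-even k k-even = cong (if_then 1ℤ else - 1ℤ) k-even

  altSign-odd : ∀ k → evenᵇ k ≡ false → altSign k ≡ - 1ℤ
  altSign-odd k k-odd = cong (if_then 1ℤ else - 1ℤ) k-odd

  three≤double : ∀ a b → 10 ℕ.* a ℕ.≤ b → + 3 * + a ≤ + 2 * + b
  three≤double a b 10a≤b = subst₂ _≤_ (ℤₚ.pos-* 3 a) (ℤₚ.pos-* 2 b)
    (+≤+ (ℕₚ.≤-trans (ℕₚ.*-monoˡ-≤ a (ℕₚ.m≤m+n 3 7)) (ℕₚ.≤-trans 10a≤b (ℕₚ.m≤m+n b (b ℕ.+ 0)))))

  deficit-weight-n-odd : ∀ {n} (S : Cube (suc n)) m → evenᵇ (suc m) ≡ false → weight S ≡ n →
    deficit S (suc m) ≡ + 2 * + binom n (suc m)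
  deficit-weight-n-odd {n} S m k-odd w≡n = begin
    deficit S (suc m)                                 ≡⟨ deficit-weight-n S m w≡n ⟩
    a + b - (altSign (suc m) * b + altSign m * a)     ≡⟨ cong₂ (λ s t → a + b - (s * b + t * a))
                                                           (altSign-odd (suc m) k-odd) (altSign-even m (not-injective k-odd)) ⟩
    a + b - (- 1ℤ * b + 1ℤ * a)                       ≡⟨ identity a b ⟩
    + 2 * b                                           ∎
    where
    open ≡-Reasoning
    a = + binom n m
    b = + binom n (suc m)
    identity : ∀ a b → a + b - (- 1ℤ * b + 1ℤ * a) ≡ + 2 * b
    identity = solve-∀

  deficit-weight-n-even : ∀ {n} (S : Cube (suc n)) m → evenᵇ (suc m) ≡ true → weight S ≡ n →
    deficit S (suc m) ≡ + 2 * + binom n m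
  deficit-weight-n-even {n} S m k-even w≡n = begin
    deficit S (suc m)                                 ≡⟨ deficit-weight-n S m w≡n ⟩
    a + b - (altSign (suc m) * b + altSign m * a)     ≡⟨ cong₂ (λ s t → a + b - (s * b + t * a))
                                                           (altSign-even (suc m) k-even) (altSign-odd m (not-injective k-even)) ⟩
    a + b - (1ℤ * b + - 1ℤ * a)                       ≡⟨ identity a b ⟩
    + 2 * a                                           ∎
    where
    open ≡-Reasoning
    a = + binom n m
    b = + binom n (suc m)
    identity : ∀ a b → a + b - (1ℤ * b + - 1ℤ * a) ≡ + 2 * a
    identity = solve-∀

  deficit-full-odd : ∀ {n} (S : Cube (suc n)) m → evenᵇ (suc m) ≡ false → weight S ≡ suc n →
    deficit S (suc m) ≡ + 2 * (+ binom n m + + binom n (suc m))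
  deficit-full-odd {n} S m k-odd w≡1+n = begin
    deficit S (suc m)                          ≡⟨ cong (λ T → deficit T (suc m)) (weight≡d⇒all-true S w≡1+n) ⟩
    deficit (replicate (suc n) true) (suc m)   ≡⟨ deficit-all-true n m ⟩
    c - altSign (suc m) * c                    ≡⟨ cong (λ s → c - s * c) (altSign-odd (suc m) k-odd) ⟩
    c - - 1ℤ * c                               ≡⟨ identity c ⟩
    + 2 * c                                    ∎
    where
    open ≡-Reasoning
    c = + binom n m + + binom n (suc m)
    identity : ∀ c → c - - 1ℤ * c ≡ + 2 * c
    identity = solve-∀

  deficit-full-even : ∀ {n} (S : Cube (suc n)) m → evenᵇ (suc m) ≡ true → weight S ≡ suc n →
    deficit S (suc m) ≡ 0ℤ
  deficit-full-even {n} S m k-even w≡1+n = begin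
    deficit S (suc m)                          ≡⟨ cong (λ T → deficit T (suc m)) (weight≡d⇒all-true S w≡1+n) ⟩
    deficit (replicate (suc n) true) (suc m)   ≡⟨ deficit-all-true n m ⟩
    c - altSign (suc m) * c                    ≡⟨ cong (λ s → c - s * c) (altSign-even (suc m) k-even) ⟩
    c - 1ℤ * c                                 ≡⟨ identity c ⟩
    0ℤ                                         ∎
    where
    open ≡-Reasoning
    c = + binom n m + + binom n (suc m)
    identity : ∀ c → c - 1ℤ * c ≡ 0ℤ
    identity = solve-∀

  deficit-heavy-odd : ∀ {n} (S : Cube (suc n)) m → evenᵇ (suc m) ≡ false → 4 ℕ.+ 11 ℕ.* suc m ℕ.≤ suc n →
    2 ℕ.≤ weight S → + 3 * + binom n m ≤ deficit S (suc m)
  deficit-heavy-odd {n} S m k-odd d-large 2≤w with 2 ℕ.+ weight S ℕ.≤? suc n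
  ... | yes 2+w≤1+n = deficit-middle S m d-large 2≤w 2+w≤1+n
  ... | no  2+w≰1+n with weight-high (weight S) (weight≤length S) 2+w≰1+n
  ...   | inj₁ 1+w≡1+n = begin
    + 3 * + binom n m                     ≤⟨ 3a≤2b ⟩
    + 2 * + binom n (suc m)               ≡⟨ deficit-weight-n-odd S m k-odd (ℕₚ.suc-injective 1+w≡1+n) ⟨
    deficit S (suc m)                     ∎
    where
    open ℤₚ.≤-Reasoning
    3a≤2b = three≤double (binom n m) (binom n (suc m)) (binom-ratio n m (ℕₚ.≤-trans (ℕₚ.m≤n+m _ 4) d-large))
  ...   | inj₂ w≡1+n = begin
    + 3 * + binom n m                     ≤⟨ 3a≤2b ⟩
    + 2 * + binom n (suc m)               ≤⟨ ℤₚ.*-monoˡ-≤-nonNeg (+ 2) (ℤₚ.i≤j+i (+ binom n (suc m)) (+ binom n m)) ⟩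
    + 2 * (+ binom n m + + binom n (suc m)) ≡⟨ deficit-full-odd S m k-odd w≡1+n ⟨
    deficit S (suc m)                     ∎
    where
    open ℤₚ.≤-Reasoning
    3a≤2b = three≤double (binom n m) (binom n (suc m)) (binom-ratio n m (ℕₚ.≤-trans (ℕₚ.m≤n+m _ 4) d-large))

  indicator-term-nonneg : ∀ c b → 0ℤ ≤ + 2 * + c * toℤ b
  indicator-term-nonneg c true  = subst (0ℤ ≤_) (sym (trans (ℤₚ.*-identityʳ (+ 2 * + c)) (sym (ℤₚ.pos-* 2 c)))) (+≤+ ℕ.z≤n)
  indicator-term-nonneg c false = subst (0ℤ ≤_) (sym (ℤₚ.*-zeroʳ (+ 2 * + c))) ℤₚ.≤-refl

  indicator-term-≤ : ∀ c b → + 2 * + c + + c * toℤ b ≤ + 3 * + c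
  indicator-term-≤ c true  = ℤₚ.≤-reflexive (identity (+ c))
    where
    identity : ∀ x → + 2 * x + x * 1ℤ ≡ + 3 * x
    identity = solve-∀
  indicator-term-≤ c false = subst (_≤ + 3 * + c) (sym (identity (+ c))) (ℤₚ.*-monoʳ-≤-nonNeg (+ c) (+≤+ (ℕₚ.m≤m+n 2 1)))
    where
    identity : ∀ x → + 2 * x + x * 0ℤ ≡ + 2 * x
    identity = solve-∀

  private
    pad : ∀ {x y} e → x ≤ y → 0ℤ ≤ e → x ≤ y + e
    pad {x} e x≤y 0≤e = ℤₚ.≤-trans (ℤₚ.≤-reflexive (sym (ℤₚ.+-identityʳ x))) (ℤₚ.+-mono-≤ x≤y 0≤e)

    no-gain : ∀ c x → x ≡ + 2 * c → + 2 * c + c * 0ℤ ≡ x + + 2 * c * 0ℤ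
    no-gain c x refl = identity c
      where
      identity : ∀ c → + 2 * c + c * 0ℤ ≡ + 2 * c + + 2 * c * 0ℤ
      identity = solve-∀

  pointwise-odd : ∀ {n} m → evenᵇ (suc m) ≡ false → 4 ℕ.+ 11 ℕ.* suc m ℕ.≤ suc n → (S : Cube (suc n)) →
    + 2 * + binom n m + + binom n m * toℤ (2 ≤ᵇ weight S) ≤ deficit S (suc m) + + 2 * + binom n m * δ (weight S) 0
  pointwise-odd {n} m k-odd d-large S with weight S in w≡
  ... | zero        = ℤₚ.≤-reflexive (trans (identity C) (cong (λ t → t + + 2 * C * 1ℤ) (sym (deficit-weight-zero S (suc m) w≡))))
    where
    C = + binom n m
    identity : ∀ c → + 2 * c + c * 0ℤ ≡ 0ℤ + + 2 * c * 1ℤ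
    identity = solve-∀
  ... | suc zero    = ℤₚ.≤-reflexive (no-gain (+ binom n m) (deficit S (suc m)) (deficit-weight-one S m w≡))
  ... | suc (suc w) = begin
    + 2 * C + C * 1ℤ                 ≤⟨ indicator-term-≤ (binom n m) true ⟩
    + 3 * C                          ≤⟨ deficit-heavy-odd S m k-odd d-large (subst (2 ℕ.≤_) (sym w≡) (ℕ.s≤s (ℕ.s≤s ℕ.z≤n))) ⟩
    deficit S (suc m)                ≡⟨ ignore-zero (deficit S (suc m)) C ⟩
    deficit S (suc m) + + 2 * C * 0ℤ ∎
    where
    open ℤₚ.≤-Reasoning
    C = + binom n m
    ignore-zero : ∀ x c → x ≡ x + + 2 * c * 0ℤ
    ignore-zero = solve-∀

  ≤ᵇ≡false : ∀ {m n} → n ℕ.< m → (m ≤ᵇ n) ≡ false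
  ≤ᵇ≡false {m} {n} n<m with m ≤ᵇ n in m≤ᵇn
  ... | false = refl
  ... | true  = ⊥-elim (ℕₚ.<⇒≱ n<m (ℕₚ.≤ᵇ⇒≤ m n (subst T (sym m≤ᵇn) tt)))

  ==ᵇ-refl : ∀ n → (n ==ᵇ n) ≡ true
  ==ᵇ-refl zero    = refl
  ==ᵇ-refl (suc n) = ==ᵇ-refl n

  pointwise-even : ∀ {n} m → evenᵇ (suc m) ≡ true → 4 ℕ.+ 11 ℕ.* suc m ℕ.≤ suc n → (S : Cube (suc n)) →
    + 2 * + binom n m + + binom n m * toℤ ((2 ≤ᵇ weight S) ∧ (weight S ≤ᵇ (suc n ∸ 2)))
      ≤ deficit S (suc m) + + 2 * + binom n m * δ (weight S) 0 + + 2 * + binom n m * δ (weight S) (suc n)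
  pointwise-even {n} m k-even d-large S with weight S in w≡
  ... | zero = ℤₚ.≤-reflexive (trans (identity C) (cong (λ t → t + + 2 * C * 1ℤ + + 2 * C * 0ℤ)
                                                       (sym (deficit-weight-zero S (suc m) w≡))))
    where
    C = + binom n m
    identity : ∀ c → + 2 * c + c * 0ℤ ≡ 0ℤ + + 2 * c * 1ℤ + + 2 * c * 0ℤ
    identity = solve-∀
  ... | suc zero = pad (+ 2 * + binom n m * δ 1 (suc n))
    (ℤₚ.≤-reflexive (no-gain (+ binom n m) (deficit S (suc m)) (deficit-weight-one S m w≡)))
    (indicator-term-nonneg (binom n m) (1 ==ᵇ suc n))
  ... | suc (suc w) with 4 ℕ.+ w ℕ.≤? suc n
  ...   | yes 4+w≤1+n = pad (+ 2 * C * δ (suc (suc w)) (suc n)) (begin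
    + 2 * C + C * toℤ (suc (suc w) ≤ᵇ (suc n ∸ 2))   ≤⟨ indicator-term-≤ (binom n m) (suc (suc w) ≤ᵇ (suc n ∸ 2)) ⟩
    + 3 * C                                           ≤⟨ deficit-middle S m d-large (subst (2 ℕ.≤_) (sym w≡) (ℕ.s≤s (ℕ.s≤s ℕ.z≤n)))
                                                                       (subst (λ t → 2 ℕ.+ t ℕ.≤ suc n) (sym w≡) 4+w≤1+n) ⟩
    deficit S (suc m)                                 ≡⟨ ignore-zero (deficit S (suc m)) C ⟩
    deficit S (suc m) + + 2 * C * 0ℤ                  ∎)
    (indicator-term-nonneg (binom n m) (suc (suc w) ==ᵇ suc n))
    where
    open ℤₚ.≤-Reasoning
    C = + binom n m
    ignore-zero : ∀ x c → x ≡ x + + 2 * c * 0ℤ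
    ignore-zero = solve-∀
  ...   | no 4+w≰1+n with weight-high (suc (suc w)) (subst (ℕ._≤ suc n) w≡ (weight≤length S)) 4+w≰1+n
  ...     | inj₁ refl = pad (+ 2 * C * δ (suc (suc w)) (suc (suc (suc w))))
    (ℤₚ.≤-reflexive (trans (cong (λ t → + 2 * C + C * toℤ t) (≤ᵇ≡false (ℕₚ.n<1+n (suc w))))
                           (no-gain C (deficit S (suc m)) (deficit-weight-n-even S m k-even w≡))))
    (indicator-term-nonneg (binom n m) (suc (suc w) ==ᵇ suc (suc (suc w))))
    where
    C = + binom n m
  ...     | inj₂ refl = ℤₚ.≤-reflexive (begin
    + 2 * C + C * toℤ (suc (suc w) ≤ᵇ w)          ≡⟨ cong (λ t → + 2 * C + C * toℤ t) (≤ᵇ≡false (ℕₚ.m≤n⇒m≤1+n (ℕₚ.n<1+n w))) ⟩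
    + 2 * C + C * 0ℤ                              ≡⟨ identity C ⟩
    0ℤ + + 2 * C * 0ℤ + + 2 * C * 1ℤ              ≡⟨ cong₂ (λ s t → s + + 2 * C * 0ℤ + + 2 * C * toℤ t)
                                                           (deficit-full-even S m k-even w≡) (==ᵇ-refl w) ⟨
    deficit S (suc m) + + 2 * C * 0ℤ + + 2 * C * δ (suc (suc w)) (suc (suc w)) ∎)
    where
    open ≡-Reasoning
    C = + binom (suc w) m
    identity : ∀ c → + 2 * c + c * 0ℤ ≡ 0ℤ + + 2 * c * 0ℤ + + 2 * c * 1ℤ
    identity = solve-∀

module Spectral where

  open import Defs
  open import Data.Bool using (Bool; true; false; _∧_; _xor_; not; if_then_else_)
  open import Data.Nat using (ℕ; zero; suc; _^_; _≤ᵇ_; _∸_)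
  open import Data.Integer using (ℤ; +_; -_; _+_; _*_; 0ℤ; 1ℤ; -[1+_]; _-_; _≤_; +≤+; nonNegative)
  open import Data.Integer.Tactic.RingSolver using (solve-∀)
  open import Data.Vec using ([]; _∷_; replicate; zipWith)
  open import Relation.Binary.PropositionalEquality
  import Data.Nat as ℕ
  import Data.Integer.Properties as ℤₚ
  open ListSum
  open Fourier
  open Krawtchouk
  open Binomial using (binom)

  χ-zero : ∀ {d} (x : Cube d) → χ (replicate d false) x ≡ 1ℤ
  χ-zero []      = refl
  χ-zero (c ∷ x) = χ-zero x

  χ-ones : ∀ {d} (x : Cube d) → χ (replicate d true) x ≡ altSign (weight x)
  χ-ones x = cong (λ y → altSign (weight y)) (all-true-∧ x)
    where
    all-true-∧ : ∀ {d} (x : Cube d) → zipWith _∧_ (replicate d true) x ≡ x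
    all-true-∧ []      = refl
    all-true-∧ (c ∷ x) = cong (c ∷_) (all-true-∧ x)

  walsh-zero : ∀ d (g : Cube d → ℤ) → walsh d g (replicate d false) ≡ ∑ (cube d) g
  walsh-zero d g = ∑-cong (cube d) (λ x → trans (cong (g x *_) (χ-zero x)) (ℤₚ.*-identityʳ (g x)))

  walsh-ones-indicator : ∀ d k b (A : Cube d → Bool) → evenᵇ k ≡ true → (∀ x → A x ≡ true → inComp k b x ≡ true) →
    walsh d (λ x → toℤ (A x)) (replicate d true) * walsh d (λ x → toℤ (A x)) (replicate d true)
      ≡ ∑ (cube d) (λ x → toℤ (A x)) * ∑ (cube d) (λ x → toℤ (A x))
  walsh-ones-indicator d k b A k-even A⊆V =
    trans (cong (λ t → t * t) (trans (∑-cong (cube d) pointwise) (∑-distribˡ-* (cube d) (parity-sign b) _)))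
          (square-sign b (∑ (cube d) (λ x → toℤ (A x))))
    where
    parity-sign : Bool → ℤ
    parity-sign b = if b then 1ℤ else - 1ℤ
    square-sign : ∀ b s → parity-sign b * s * (parity-sign b * s) ≡ s * s
    square-sign true  s = cong (λ t → t * t) (ℤₚ.*-identityˡ s)
    square-sign false s = identity s
      where
      identity : ∀ s → - 1ℤ * s * (- 1ℤ * s) ≡ s * s
      identity = solve-∀
    same-parity : ∀ p b → (p ≡ᵇ b) ≡ true → parity-sign p ≡ parity-sign b
    same-parity true  true  _ = refl
    same-parity false false _ = refl
    same-parity true  false ()
    same-parity false true  ()
    pointwise : ∀ x → toℤ (A x) * χ (replicate d true) x ≡ parity-sign b * toℤ (A x)
    pointwise x with A x in Ax
    ... | false = trans (ℤₚ.*-zeroˡ (χ (replicate d true) x)) (sym (ℤₚ.*-zeroʳ (parity-sign b)))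
    ... | true  = trans (ℤₚ.*-identityˡ _) (trans (χ-ones x)
        (trans (same-parity (evenᵇ (weight x)) b (subst (λ e → (if e then _ else true) ≡ true) k-even (A⊆V x Ax)))
               (sym (ℤₚ.*-identityʳ (parity-sign b)))))

  ∑-δ-weight-zero : ∀ d (g : Cube d → ℤ) → ∑ (cube d) (λ S → g S * δ (weight S) 0) ≡ g (replicate d false)
  ∑-δ-weight-zero zero    g = identity (g [])
    where
    identity : ∀ a → a * 1ℤ + 0ℤ ≡ a
    identity = solve-∀
  ∑-δ-weight-zero (suc d) g =
    trans (∑-cube-suc d _) (trans (∑-cong (cube d) (λ S → drop-zero (g (false ∷ S) * δ (weight S) 0) (g (true ∷ S))))
                                  (∑-δ-weight-zero d (slice false g)))
    where
    drop-zero : ∀ a b → a + b * 0ℤ ≡ a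
    drop-zero = solve-∀

  ∑-δ-weight-full : ∀ d (g : Cube d → ℤ) → ∑ (cube d) (λ S → g S * δ (weight S) d) ≡ g (replicate d true)
  ∑-δ-weight-full zero    g = identity (g [])
    where
    identity : ∀ a → a * 1ℤ + 0ℤ ≡ a
    identity = solve-∀
  ∑-δ-weight-full (suc d) g =
    trans (∑-cube-suc d _) (trans (∑-cong (cube d) (λ S → trans (cong (λ t → g (false ∷ S) * t + g (true ∷ S) * δ (weight S) d)
                                                                      (short (weight S) d (weight≤length S)))
                                                                (drop-zero (g (false ∷ S)) (g (true ∷ S) * δ (weight S) d))))
                                  (∑-δ-weight-full d (slice true g)))
    where
    drop-zero : ∀ a b → a * 0ℤ + b ≡ b
    drop-zero = solve-∀
    short : ∀ w d → w ℕ.≤ d → δ w (suc d) ≡ 0ℤ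
    short zero    d       _           = refl
    short (suc w) (suc d) (ℕ.s≤s w≤d) = short w d w≤d

  compSize-odd : ∀ d k b → evenᵇ k ≡ false → + compSize d k b ≡ + 2 ^ d
  compSize-odd d k b k-odd =
    trans (length-filter-true (cube d) (inComp k b))
          (trans (∑-cong (cube d) (λ x → cong (λ e → toℤ (if e then _ else true)) k-odd)) (∑-cube-one d))

  compSize-even : ∀ n k b → evenᵇ k ≡ true → + compSize (suc n) k b ≡ + 2 ^ n
  compSize-even n k b k-even =
    trans (length-filter-true (cube (suc n)) (inComp k b))
          (trans (∑-cube-suc n _) (trans (∑-cong (cube n) one-of-two) (∑-cube-one n)))
    where
    one-of-two′ : ∀ p b → toℤ (p ≡ᵇ b) + toℤ (not p ≡ᵇ b) ≡ 1ℤ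
    one-of-two′ true  true  = refl
    one-of-two′ true  false = refl
    one-of-two′ false true  = refl
    one-of-two′ false false = refl
    one-of-two : ∀ (x : Cube n) → toℤ (inComp k b (false ∷ x)) + toℤ (inComp k b (true ∷ x)) ≡ 1ℤ
    one-of-two x rewrite k-even = one-of-two′ (evenᵇ (weight x)) b

  square-nonneg : ∀ i → 0ℤ ≤ i * i
  square-nonneg (+ n)      = subst (0ℤ ≤_) (ℤₚ.pos-* n n) (+≤+ ℕ.z≤n)
  square-nonneg -[1+ n ]   = +≤+ ℕ.z≤n

  module _ (d k : ℕ) (b : Bool) (A : Cube d → Bool) (A⊆V : ∀ x → A x ≡ true → inComp k b x ≡ true) where

    private
      F : Cube d → ℤ
      F = walsh d (λ x → toℤ (A x))

    spectral-inequality : ∀ (C : ℤ) (P : Cube d → Bool) (X : Cube d → ℤ) →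
      (∀ S → + 2 * C + C * toℤ (P S) ≤ deficit S k + X S) →
      + 2 * C * (+ 2 ^ d * ∑ (cube d) (λ x → toℤ (A x))) + C * ∑ (cube d) (λ S → F S * F S * toℤ (P S))
        ≤ + 2 ^ d * + boundarySize d k b A + ∑ (cube d) (λ S → F S * F S * X S)
    spectral-inequality C P X pointwise = begin
      + 2 * C * (+ 2 ^ d * ∑ (cube d) (λ x → toℤ (A x))) + C * ∑ (cube d) (λ S → F S * F S * toℤ (P S))
        ≡⟨ cong₂ (λ s t → + 2 * C * s + t) (parseval-indicator d A) (∑-distribˡ-* (cube d) C _) ⟨
      + 2 * C * ∑ (cube d) (λ S → F S * F S) + ∑ (cube d) (λ S → C * (F S * F S * toℤ (P S)))
        ≡⟨ cong (_+ ∑ (cube d) (λ S → C * (F S * F S * toℤ (P S)))) (∑-distribˡ-* (cube d) (+ 2 * C) _) ⟨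
      ∑ (cube d) (λ S → + 2 * C * (F S * F S)) + ∑ (cube d) (λ S → C * (F S * F S * toℤ (P S)))
        ≡⟨ ∑-distrib-+ (cube d) _ _ ⟨
      ∑ (cube d) (λ S → + 2 * C * (F S * F S) + C * (F S * F S * toℤ (P S)))
        ≡⟨ ∑-cong (cube d) (λ S → factor (F S * F S) C (toℤ (P S))) ⟩
      ∑ (cube d) (λ S → F S * F S * (+ 2 * C + C * toℤ (P S)))
        ≤⟨ ∑-mono-≤ (cube d) (λ S → ℤₚ.*-monoˡ-≤-nonNeg (F S * F S) {{nonNegative (square-nonneg (F S))}} (pointwise S)) ⟩
      ∑ (cube d) (λ S → F S * F S * (deficit S k + X S))
        ≡⟨ ∑-cong (cube d) (λ S → ℤₚ.*-distribˡ-+ (F S * F S) (deficit S k) (X S)) ⟩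
      ∑ (cube d) (λ S → F S * F S * deficit S k + F S * F S * X S)
        ≡⟨ ∑-distrib-+ (cube d) _ _ ⟩
      ∑ (cube d) (λ S → F S * F S * deficit S k) + ∑ (cube d) (λ S → F S * F S * X S)
        ≡⟨ cong (_+ ∑ (cube d) (λ S → F S * F S * X S)) (spectral-boundary d k b A A⊆V) ⟩
      + 2 ^ d * + boundarySize d k b A + ∑ (cube d) (λ S → F S * F S * X S) ∎
      where
      open ℤₚ.≤-Reasoning
      factor : ∀ q c t → + 2 * c * q + c * (q * t) ≡ q * (+ 2 * c + c * t)
      factor = solve-∀

  ∑-scaled-δ : ∀ d (g : Cube d → ℤ) c w → ∑ (cube d) (λ S → g S * (c * δ (weight S) w)) ≡ c * ∑ (cube d) (λ S → g S * δ (weight S) w)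
  ∑-scaled-δ d g c w = trans (∑-cong (cube d) (λ S → swap (g S) c (δ (weight S) w))) (∑-distribˡ-* (cube d) c _)
    where
    swap : ∀ x c y → x * (c * y) ≡ c * (x * y)
    swap = solve-∀

  module _ {n : ℕ} (m : ℕ) (b : Bool) (A : Cube (suc n) → Bool) (A⊆V : ∀ x → A x ≡ true → inComp (suc m) b x ≡ true)
           (d-large : 4 ℕ.+ 11 ℕ.* suc m ℕ.≤ suc n) where

    private
      F : Cube (suc n) → ℤ
      F = walsh (suc n) (λ x → toℤ (A x))
      a C U E : ℤ
      a = ∑ (cube (suc n)) (λ x → toℤ (A x))
      C = + binom n m
      U = + 2 ^ suc n
      E = + boundarySize (suc n) (suc m) b A
      q : Cube (suc n) → ℤ
      q S = F S * F S
      mass-at-zero : ∑ (cube (suc n)) (λ S → q S * (+ 2 * C * δ (weight S) 0)) ≡ + 2 * C * (a * a)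
      mass-at-zero = trans (∑-scaled-δ (suc n) q (+ 2 * C) 0)
        (cong (+ 2 * C *_) (trans (∑-δ-weight-zero (suc n) q) (cong (λ t → t * t) (walsh-zero (suc n) _))))

    spectral-odd : evenᵇ (suc m) ≡ false →
      + 2 * C * (U * a) + C * ∑ (cube (suc n)) (λ S → q S * toℤ (2 ≤ᵇ weight S)) ≤ U * E + + 2 * C * (a * a)
    spectral-odd k-odd = ℤₚ.≤-trans
      (spectral-inequality (suc n) (suc m) b A A⊆V C (λ S → 2 ≤ᵇ weight S) (λ S → + 2 * C * δ (weight S) 0)
                           (pointwise-odd m k-odd d-large))
      (ℤₚ.≤-reflexive (cong (_+_ (U * E)) mass-at-zero))

    spectral-even : evenᵇ (suc m) ≡ true →
      + 2 * C * (U * a) + C * ∑ (cube (suc n)) (λ S → q S * toℤ ((2 ≤ᵇ weight S) ∧ (weight S ≤ᵇ (suc n ∸ 2))))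
        ≤ U * E + + 2 * C * (a * a + a * a)
    spectral-even k-even = ℤₚ.≤-trans
      (spectral-inequality (suc n) (suc m) b A A⊆V C (λ S → (2 ≤ᵇ weight S) ∧ (weight S ≤ᵇ (suc n ∸ 2)))
                           (λ S → + 2 * C * δ (weight S) 0 + + 2 * C * δ (weight S) (suc n))
                           (λ S → ℤₚ.≤-trans (pointwise-even m k-even d-large S) (ℤₚ.≤-reflexive (ℤₚ.+-assoc (deficit S (suc m)) (+ 2 * C * δ (weight S) 0) _))))
      (ℤₚ.≤-reflexive (cong (_+_ (U * E)) masses))
      where
      mass-at-ones : ∑ (cube (suc n)) (λ S → q S * (+ 2 * C * δ (weight S) (suc n))) ≡ + 2 * C * (a * a)
      mass-at-ones = trans (∑-scaled-δ (suc n) q (+ 2 * C) (suc n))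
        (cong (+ 2 * C *_) (trans (∑-δ-weight-full (suc n) q) (walsh-ones-indicator (suc n) (suc m) b A k-even A⊆V)))
      masses : ∑ (cube (suc n)) (λ S → q S * (+ 2 * C * δ (weight S) 0 + + 2 * C * δ (weight S) (suc n)))
             ≡ + 2 * C * (a * a + a * a)
      masses = trans (∑-cong (cube (suc n)) (λ S → ℤₚ.*-distribˡ-+ (q S) _ _))
        (trans (∑-distrib-+ (cube (suc n)) _ _)
          (trans (cong₂ _+_ mass-at-zero mass-at-ones) (sym (ℤₚ.*-distribˡ-+ (+ 2 * C) (a * a) (a * a)))))

module Arithmetic where

  open import Defs
  open import Data.Bool using (Bool; true; false)
  open import Data.Nat using (ℕ; zero; suc; _^_; NonZero)
  open import Data.Integer using (ℤ; +_; _+_; _*_; _≤_; 0ℤ; 1ℤ; _-_; +≤+; nonNegative; positive)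
  open import Data.Integer.Tactic.RingSolver using (solve-∀)
  open import Data.List using (List; []; _∷_; map; filter)
  open import Data.Rational using (ℚ; mkℚ; toℚᵘ; 1ℚ; ½; 0ℚ)
  open import Data.Rational.Unnormalised using (ℚᵘ; mkℚᵘ; *≡*; *≤*; _≃_)
  open import Relation.Binary.PropositionalEquality
  open import Data.Product using (_×_; _,_)
  import Data.Bool as Bool
  import Data.Nat as ℕ
  import Data.Nat.Properties as ℕₚ
  import Data.Nat.Tactic.RingSolver
  import Data.Integer.Properties as ℤₚ
  import Data.Rational as ℚ
  import Data.Rational.Properties as ℚₚ
  import Data.Rational.Unnormalised as ℚᵘ
  import Data.Rational.Unnormalised.Properties as ℚᵘₚ
  import Data.Nat.Combinatorics as Combinatorics
  open ListSum
  open Fourier using (walsh)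
  open Binomial using (binom; binom-pos; binom≡C)
  open Spectral using (compSize-even; compSize-odd)

  toℚᵘ-/ : ∀ z n .{{_ : NonZero n}} → toℚᵘ (z ℚ./ n) ≃ z ℚᵘ./ n
  toℚᵘ-/ z (suc n) = ℚₚ.toℚᵘ-fromℚᵘ (mkℚᵘ z n)

  +-/-same : ∀ a b n .{{_ : NonZero n}} → (a ℚᵘ./ n) ℚᵘ.+ (b ℚᵘ./ n) ≃ (a + b) ℚᵘ./ n
  +-/-same a b (suc n) = *≡* (trans (identity a b (+ suc n)) (cong ((a + b) *_) (sym (ℤₚ.pos-* (suc n) (suc n)))))
    where
    identity : ∀ a b N → (a * N + b * N) * N ≡ (a + b) * (N * N)
    identity = solve-∀

  sum-of-squares : ∀ {A : Set} (xs : List A) (G : A → ℤ) n .{{_ : NonZero n}} →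
    toℚᵘ (sumℚ (map (λ x → (G x ℚ./ n) ℚ.* (G x ℚ./ n)) xs)) ≃ (∑ xs (λ x → G x * G x) ℚᵘ./ (n ℕ.* n)) {{ℕₚ.m*n≢0 n n}}
  sum-of-squares []       G (suc n) = *≡* refl
  sum-of-squares (x ∷ xs) G (suc n) =
    ℚᵘₚ.≃-trans (ℚₚ.toℚᵘ-homo-+ (square x) _)
    (ℚᵘₚ.≃-trans (ℚᵘₚ.+-cong (ℚᵘₚ.≃-trans (ℚₚ.toℚᵘ-homo-* (G x ℚ./ suc n) _)
                                          (ℚᵘₚ.*-cong (toℚᵘ-/ (G x) (suc n)) (toℚᵘ-/ (G x) (suc n))))
                             (sum-of-squares xs G (suc n)))
                 (+-/-same (G x * G x) (∑ xs (λ x → G x * G x)) (suc n ℕ.* suc n)))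
    where
    square : _ → ℚ
    square x = (G x ℚ./ suc n) ℚ.* (G x ℚ./ suc n)

  fourierWeight-≤ : ∀ d (A P : Cube d → Bool) (ε : ℚ) →
    + 2 * ℚ.↧ ε * ∑ (cube d) (λ S → walsh d (λ x → toℤ (A x)) S * walsh d (λ x → toℤ (A x)) S * toℤ (P S))
      ≤ ℚ.↥ ε * (+ 2 ^ d * + 2 ^ d) →
    fourierWeight d A P ℚ.≤ ε ℚ.* ½
  fourierWeight-≤ d A P ε@(mkℚ p e _) 2↧εW≤↥εU² =
    ℚₚ.toℚᵘ-cancel-≤ (ℚᵘₚ.≤-respˡ-≃ (ℚᵘₚ.≃-sym squares)
                     (ℚᵘₚ.≤-respʳ-≃ (ℚᵘₚ.≃-sym (ℚₚ.toℚᵘ-homo-* ε ½)) (*≤* cross-multiplied)))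
    where
    F = walsh d (λ x → toℤ (A x))
    Pset = filter (λ S → P S Bool.≟ true) (cube d)
    instance
      2^d≢0 : NonZero (2 ^ d)
      2^d≢0 = ℕₚ.m^n≢0 2 d
      2^2d≢0 : NonZero (2 ^ d ℕ.* 2 ^ d)
      2^2d≢0 = ℕₚ.m*n≢0 (2 ^ d) (2 ^ d)
    squares = sum-of-squares Pset F (2 ^ d)
    W = ∑ (cube d) (λ S → F S * F S * toℤ (P S))
    Q = ∑ Pset (λ S → F S * F S) ℚᵘ./ (2 ^ d ℕ.* 2 ^ d)
    ↥Q≡W : ℚᵘ.↥ Q ≡ W
    ↥Q≡W = trans (ℚᵘₚ.↥[n/d]≡n _ (2 ^ d ℕ.* 2 ^ d)) (∑-filter-true (cube d) P (λ S → F S * F S))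
    ↧Q≡U² : ℚᵘ.↧ Q ≡ + 2 ^ d * + 2 ^ d
    ↧Q≡U² = trans (ℚᵘₚ.↧[n/d]≡d _ (2 ^ d ℕ.* 2 ^ d)) (ℤₚ.pos-* (2 ^ d) (2 ^ d))
    reorder : ∀ W s → + 2 * s * W ≡ W * (s * + 2)
    reorder = solve-∀
    cross-multiplied : ℚᵘ.↥ Q * ℚᵘ.↧ (toℚᵘ ε ℚᵘ.* toℚᵘ ½) ≤ ℚᵘ.↥ (toℚᵘ ε ℚᵘ.* toℚᵘ ½) * ℚᵘ.↧ Q
    cross-multiplied = subst₂ _≤_
      (trans (reorder W (+ suc e)) (cong₂ _*_ (sym ↥Q≡W) (sym (ℤₚ.pos-* (suc e) 2))))
      (cong₂ _*_ (sym (ℤₚ.*-identityʳ p)) (sym ↧Q≡U²))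
      2↧εW≤↥εU²

  boundary-bound : ∀ (E c a : ℕ) (ε : ℚ) → ℕtoℚ E ℚ.≤ (1ℚ ℚ.+ ε) ℚ.* ℕtoℚ c ℚ.* ℕtoℚ a →
    ℚ.↧ ε * + E ≤ (ℚ.↧ ε + ℚ.↥ ε) * + c * + a
  boundary-bound E c a ε@(mkℚ p e _) E≤[1+ε]ca =
    subst₂ _≤_ (trans (cong (+ E *_) ↧R) (ℤₚ.*-comm (+ E) (+ suc e))) (trans (ℤₚ.*-identityʳ _) ↥R)
      (ℚᵘₚ.drop-*≤* (ℚᵘₚ.≤-respʳ-≃ toℚᵘR (ℚᵘₚ.≤-respˡ-≃ (toℚᵘ-/ (+ E) 1) (ℚₚ.toℚᵘ-mono-≤ E≤[1+ε]ca))))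
    where
    R = (toℚᵘ 1ℚ ℚᵘ.+ toℚᵘ ε) ℚᵘ.* (+ c ℚᵘ./ 1) ℚᵘ.* (+ a ℚᵘ./ 1)
    toℚᵘR : toℚᵘ ((1ℚ ℚ.+ ε) ℚ.* ℕtoℚ c ℚ.* ℕtoℚ a) ≃ R
    toℚᵘR = ℚᵘₚ.≃-trans (ℚₚ.toℚᵘ-homo-* ((1ℚ ℚ.+ ε) ℚ.* ℕtoℚ c) (ℕtoℚ a))
              (ℚᵘₚ.*-cong (ℚᵘₚ.≃-trans (ℚₚ.toℚᵘ-homo-* (1ℚ ℚ.+ ε) (ℕtoℚ c))
                                       (ℚᵘₚ.*-cong (ℚₚ.toℚᵘ-homo-+ 1ℚ ε) (toℚᵘ-/ (+ c) 1)))
                          (toℚᵘ-/ (+ a) 1))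
    ↧R : ℚᵘ.↧ R ≡ + suc e
    ↧R = cong (λ n → + suc n) (unit-factors e)
      where
      unit-factors : ∀ e → (e ℕ.+ 0 ℕ.* suc e) ℕ.* 1 ℕ.* 1 ≡ e
      unit-factors = Data.Nat.Tactic.RingSolver.solve-∀
    ↥R : ℚᵘ.↥ R ≡ (+ suc e + p) * + c * + a
    ↥R = unit-factors (+ suc e) p (+ c) (+ a)
      where
      unit-factors : ∀ s p c a → (1ℤ * s + p * 1ℤ) * c * a ≡ (s + p) * c * a
      unit-factors = solve-∀

  ↥-nonneg : ∀ ε → ℚ.0ℚ ℚ.≤ ε → 0ℤ ≤ ℚ.↥ ε
  ↥-nonneg (mkℚ p e _) 0≤ε =
    subst₂ _≤_ (ℤₚ.*-zeroˡ (+ suc e)) (ℤₚ.*-identityʳ p) (ℚᵘₚ.drop-*≤* (ℚₚ.toℚᵘ-mono-≤ 0≤ε))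

  -- The four hypotheses, weighted by 2S, 2U, 2CS and CUP, add up to C times the conclusion.
  slack-certificate : ∀ {S P C a U E W T} → 0ℤ ≤ S → 0ℤ ≤ P → 1ℤ ≤ C → 0ℤ ≤ U →
    + 2 * C * (U * a) + C * W ≤ U * E + + 2 * C * T →
    S * E ≤ (S + P) * C * a →
    + 2 * T ≤ U * a →
    + 2 * a ≤ U →
    + 2 * S * W ≤ P * (U * U)
  slack-certificate {S} {P} {C} {a} {U} {E} {W} {T} 0≤S 0≤P 1≤C 0≤U h₁ h₂ h₃ h₄ =
    ℤₚ.0≤i-j⇒j≤i (ℤₚ.*-cancelˡ-≤-pos 0ℤ _ C {{positive (ℤₚ.<-≤-trans (+<+ (ℕ.s≤s ℕ.z≤n)) 1≤C)}}
      (subst₂ _≤_ (sym (ℤₚ.*-zeroʳ C)) (sym certificate) weighted-slacks))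
    where
    open Data.Integer using (+<+)
    0≤C = ℤₚ.≤-trans (+≤+ ℕ.z≤n) 1≤C
    0≤2 : 0ℤ ≤ + 2
    0≤2 = +≤+ ℕ.z≤n
    nonneg-* : ∀ {x y} → 0ℤ ≤ x → 0ℤ ≤ y → 0ℤ ≤ x * y
    nonneg-* {x} {y} 0≤x 0≤y = subst (_≤ x * y) (ℤₚ.*-zeroˡ y) (ℤₚ.*-monoʳ-≤-nonNeg y {{nonNegative 0≤y}} 0≤x)
    slack₁ = U * E + + 2 * C * T - (+ 2 * C * (U * a) + C * W)
    slack₂ = (S + P) * C * a - S * E
    slack₃ = U * a - + 2 * T
    slack₄ = U - + 2 * a
    certificate : C * (P * (U * U) - + 2 * S * W)
                ≡ + 2 * S * slack₁ + + 2 * U * slack₂ + + 2 * C * S * slack₃ + C * U * P * slack₄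
    certificate = identity S P C a U E W T
      where
      identity : ∀ S P C a U E W T → C * (P * (U * U) - + 2 * S * W) ≡
          + 2 * S * (U * E + + 2 * C * T - (+ 2 * C * (U * a) + C * W)) + + 2 * U * ((S + P) * C * a - S * E)
        + + 2 * C * S * (U * a - + 2 * T) + C * U * P * (U - + 2 * a)
      identity = solve-∀
    weighted-slacks : 0ℤ ≤ + 2 * S * slack₁ + + 2 * U * slack₂ + + 2 * C * S * slack₃ + C * U * P * slack₄
    weighted-slacks = ℤₚ.+-mono-≤ (ℤₚ.+-mono-≤ (ℤₚ.+-mono-≤
      (nonneg-* (nonneg-* 0≤2 0≤S) (ℤₚ.i≤j⇒0≤j-i h₁))
      (nonneg-* (nonneg-* 0≤2 0≤U) (ℤₚ.i≤j⇒0≤j-i h₂)))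
      (nonneg-* (nonneg-* (nonneg-* 0≤2 0≤C) 0≤S) (ℤₚ.i≤j⇒0≤j-i h₃)))
      (nonneg-* (nonneg-* (nonneg-* 0≤C 0≤U) 0≤P) (ℤₚ.i≤j⇒0≤j-i h₄))

  module _ {n : ℕ} (m : ℕ) (b : Bool) (A : Cube (suc n) → Bool) where

    private
      a C U E : ℤ
      a = ∑ (cube (suc n)) (λ x → toℤ (A x))
      C = + binom n m
      U = + 2 ^ suc n
      E = + boundarySize (suc n) (suc m) b A
      F : Cube (suc n) → ℤ
      F = walsh (suc n) (λ x → toℤ (A x))
      0≤a : 0ℤ ≤ a
      0≤a = subst (0ℤ ≤_) (length-filter-true (cube (suc n)) A) (+≤+ ℕ.z≤n)
      half-of-component : 2 ℕ.* setSize (suc n) A ℕ.≤ compSize (suc n) (suc m) b → + 2 * a ≤ + compSize (suc n) (suc m) b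
      half-of-component 2|A|≤|V| =
        subst (_≤ + compSize (suc n) (suc m) b)
              (trans (ℤₚ.pos-* 2 (setSize (suc n) A)) (cong (+ 2 *_) (length-filter-true (cube (suc n)) A)))
              (+≤+ 2|A|≤|V|)

    size-bounds-odd : evenᵇ (suc m) ≡ false → 2 ℕ.* setSize (suc n) A ℕ.≤ compSize (suc n) (suc m) b →
      + 2 * (a * a) ≤ U * a × + 2 * a ≤ U
    size-bounds-odd k-odd 2|A|≤|V| = subst (_≤ U * a) (reassoc a) (ℤₚ.*-monoʳ-≤-nonNeg a {{nonNegative 0≤a}} 2a≤U) , 2a≤U
      where
      2a≤U = subst (+ 2 * a ≤_) (compSize-odd (suc n) (suc m) b k-odd) (half-of-component 2|A|≤|V|)
      reassoc : ∀ a → + 2 * a * a ≡ + 2 * (a * a)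
      reassoc = solve-∀

    size-bounds-even : evenᵇ (suc m) ≡ true → 2 ℕ.* setSize (suc n) A ℕ.≤ compSize (suc n) (suc m) b →
      + 2 * (a * a + a * a) ≤ U * a × + 2 * a ≤ U
    size-bounds-even k-even 2|A|≤|V| =
      subst (_≤ U * a) (reassoc a) (ℤₚ.*-monoʳ-≤-nonNeg a {{nonNegative 0≤a}} 4a≤U) ,
      ℤₚ.≤-trans (ℤₚ.≤-trans (ℤₚ.≤-reflexive (sym (ℤₚ.+-identityʳ (+ 2 * a)))) (ℤₚ.+-monoʳ-≤ (+ 2 * a) 0≤2a)) 4a≤U
      where
      2a≤2^n = subst (+ 2 * a ≤_) (compSize-even n (suc m) b k-even) (half-of-component 2|A|≤|V|)
      0≤2a = ℤₚ.*-monoˡ-≤-nonNeg (+ 2) 0≤a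
      4a≤U : + 2 * a + + 2 * a ≤ U
      4a≤U = subst (+ 2 * a + + 2 * a ≤_) (trans (double (+ 2 ^ n)) (sym (ℤₚ.pos-* 2 (2 ^ n)))) (ℤₚ.+-mono-≤ 2a≤2^n 2a≤2^n)
        where
        double : ∀ x → x + x ≡ + 2 * x
        double = solve-∀
      reassoc : ∀ a → (+ 2 * a + + 2 * a) * a ≡ + 2 * (a * a + a * a)
      reassoc = solve-∀

    tail-bound : (P : Cube (suc n) → Bool) (T : ℤ) (ε : ℚ) → 4 ℕ.+ 11 ℕ.* suc m ℕ.≤ suc n → 0ℚ ℚ.≤ ε →
      ℕtoℚ (boundarySize (suc n) (suc m) b A) ℚ.≤ (1ℚ ℚ.+ ε) ℚ.* ℕtoℚ (n Combinatorics.C m) ℚ.* ℕtoℚ (setSize (suc n) A) →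
      + 2 * C * (U * a) + C * ∑ (cube (suc n)) (λ S → F S * F S * toℤ (P S)) ≤ U * E + + 2 * C * T →
      + 2 * T ≤ U * a × + 2 * a ≤ U →
      fourierWeight (suc n) A P ℚ.≤ ε ℚ.* ½
    tail-bound P T ε d-large 0≤ε boundary≤ spectral (2T≤Ua , 2a≤U) =
      fourierWeight-≤ (suc n) A P ε
        (slack-certificate (+≤+ ℕ.z≤n) (↥-nonneg ε 0≤ε) (+≤+ (binom-pos m≤n)) (+≤+ ℕ.z≤n)
                           spectral boundary≤′ 2T≤Ua 2a≤U)
      where
      m≤n : m ℕ.≤ n
      m≤n = ℕ.s≤s⁻¹ (ℕₚ.≤-trans (ℕₚ.m≤n*m (suc m) 11) (ℕₚ.≤-trans (ℕₚ.m≤n+m _ 4) d-large))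
      boundary≤′ : ℚ.↧ ε * E ≤ (ℚ.↧ ε + ℚ.↥ ε) * C * a
      boundary≤′ = subst₂ (λ c t → ℚ.↧ ε * E ≤ (ℚ.↧ ε + ℚ.↥ ε) * + c * t) (sym (binom≡C n m)) (length-filter-true (cube (suc n)) A)
                          (boundary-bound (boundarySize (suc n) (suc m) b A) (n Combinatorics.C m) (setSize (suc n) A) ε boundary≤)

open import Defs
open import Data.Bool using (Bool; true; false; _∧_)
open import Data.Nat using (ℕ; _≤_; _≤ᵇ_; _∸_; _*_)
open import Data.Nat.Combinatorics using (_C_)
open import Data.Product using (Σ; _×_)
open import Data.Rational using (ℚ; ½; 1ℚ; 0ℚ)
import Data.Rational as ℚ
open import Relation.Binary.PropositionalEquality using (_≡_)
open import Data.Nat using (zero; suc; _+_)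
open import Data.Product using (_,_)
open Spectral using (spectral-odd; spectral-even)
open Arithmetic using (tail-bound; size-bounds-odd; size-bounds-even)

corollary2 : (k : ℕ) → 1 ≤ k →
    Σ ℕ λ d₀ → (d : ℕ) → d₀ ≤ d →
    (b : Bool) → (A : Cube d → Bool) →
    ((x : Cube d) → A x ≡ true → inComp k b x ≡ true) →
    2 * setSize d A ≤ compSize d k b →
    (ε : ℚ) → 0ℚ ℚ.≤ ε →
    ℕtoℚ (boundarySize d k b A) ℚ.≤ (1ℚ ℚ.+ ε) ℚ.* ℕtoℚ ((d ∸ 1) C (k ∸ 1)) ℚ.* ℕtoℚ (setSize d A) →
    (evenᵇ k ≡ false → fourierWeight d A (λ S → 2 ≤ᵇ weight S) ℚ.≤ ε ℚ.* ½)
    × (evenᵇ k ≡ true → fourierWeight d A (λ S → (2 ≤ᵇ weight S) ∧ (weight S ≤ᵇ (d ∸ 2))) ℚ.≤ ε ℚ.* ½)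
corollary2 zero    ()
corollary2 (suc m) _ = 4 + 11 * suc m , λ where
  zero    ()
  (suc n) d-large b A A⊆V 2|A|≤|V| ε 0≤ε boundary≤ →
      (λ k-odd → tail-bound m b A _ _ ε d-large 0≤ε boundary≤
                   (spectral-odd m b A A⊆V d-large k-odd)
                   (size-bounds-odd m b A k-odd 2|A|≤|V|))
    , (λ k-even → tail-bound m b A _ _ ε d-large 0≤ε boundary≤
                   (spectral-even m b A A⊆V d-large k-even)
                   (size-bounds-even m b A k-even 2|A|≤|V|))
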